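{- For all $n,j\ge 0$ and all $k\ge 2$, $$a^{(k)}_{n,231,j}=\sum_{j\ge i_{k-1}\ge\cdots\ge i_1\ge 0}\ \prod_{m=0}^{k-1}\binom{i_{m+2}+i_m}{2i_{m+1}},$$ where $i_0:=0$, $i_k:=j$, $i_{k+1}:=n$, and the sum is over integers $i_1,\dots,i_{k-1}$.
   Context: For $n\ge 1$ and $j,k\ge 0$, $a^{(k)}_{n,231,j}$ denotes the number of permutations $\sigma=\sigma_1\cdots\sigma_n$ of $[n]$ that avoid $231$ (no indices $a<b<c$ with $\sigma_c<\sigma_a<\sigma_b$), have exactly $j$ descents (indices $i\in[n-1]$ with $\sigma_i>\sigma_{i+1}$), and satisfy $\max\{i-\sigma_i: i\in[n]\}\le k$. For $n=0$ the convention is $a^{(k)}_{0,231,0}=1$ and $a^{(k)}_{0,231,j}=0$ for $j>0$. -}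

module Defs where

open import Data.Bool using (Bool; true; false; _∧_; not)
open import Data.Nat using (ℕ; zero; suc; _+_; _*_; _∸_; _≤ᵇ_; _<ᵇ_; _≡ᵇ_)
open import Data.Nat.Combinatorics using (_C_)
open import Data.List using (List; []; _∷_; _++_; map; concatMap; length; filterᵇ; applyUpTo)
open import Data.Bool.ListAction using (all; any)
open import Data.Nat.ListAction using (sum)

-- [a .. b] as a list of naturals (empty if b < a)
range : ℕ → ℕ → List ℕ
range a b = applyUpTo (λ t → a + t) (suc b ∸ a)

words : ℕ → ℕ → List (List ℕ)
words zero    n = [] ∷ []
words (suc l) n = concatMap (λ v → map (v ∷_) (words l n)) (range 1 n)

-- σ_i for 1-based index i (0 if out of range; never used out of range)
at : List ℕ → ℕ → ℕ
at []       _             = 0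
at (x ∷ xs) zero          = 0
at (x ∷ xs) (suc zero)    = x
at (x ∷ xs) (suc (suc i)) = at xs (suc i)

distinct : List ℕ → Bool
distinct []       = true
distinct (x ∷ xs) = not (any (λ y → x ≡ᵇ y) xs) ∧ distinct xs

-- permutations of [n], written in one-line notation σ₁ ⋯ σₙ
perms : ℕ → List (List ℕ)
perms n = filterᵇ distinct (words n n)

contains231 : ℕ → List ℕ → Bool
contains231 n σ =
  any (λ a → any (λ b → any (λ c → (at σ c <ᵇ at σ a) ∧ (at σ a <ᵇ at σ b))
                              (range (suc b) n))
                 (range (suc a) n))
      (range 1 n)

des : ℕ → List ℕ → ℕ
des n σ = length (filterᵇ (λ i → at σ (suc i) <ᵇ at σ i) (range 1 (n ∸ 1)))

-- max { i - σ_i : i ∈ [n] } ≤ k   (i ∸ σ_i ≤ k ⇔ i - σ_i ≤ k since k ≥ 0)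
boundedBy : ℕ → ℕ → List ℕ → Bool
boundedBy n k σ = all (λ i → (i ∸ at σ i) ≤ᵇ k) (range 1 n)

a231 : ℕ → ℕ → ℕ → ℕ
a231 k n j = length (filterᵇ
  (λ σ → not (contains231 n σ) ∧ ((des n σ ≡ᵇ j) ∧ boundedBy n k σ))
  (perms n))

chains : ℕ → ℕ → ℕ → List (List ℕ)
chains zero    lo hi = [] ∷ []
chains (suc l) lo hi = concatMap (λ v → map (v ∷_) (chains l v hi)) (range lo hi)

tripleProd : List ℕ → ℕ
tripleProd (x ∷ y ∷ z ∷ rest) = ((z + x) C (2 * y)) * tripleProd (y ∷ z ∷ rest)
tripleProd _                  = 1

-- Σ_{j ≥ i_{k-1} ≥ ⋯ ≥ i_1 ≥ 0} ∏_{m=0}^{k-1} C(i_{m+2}+i_m, 2 i_{m+1}),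
-- with i₀ = 0, i_k = j, i_{k+1} = n; the chain (i₁,…,i_{k-1}) has length k ∸ 1
rhs : ℕ → ℕ → ℕ → ℕ
rhs k n j = sum (map (λ c → tripleProd (0 ∷ c ++ (j ∷ n ∷ []))) (chains (k ∸ 1) 0 j))

module Submission where

-- Let count p k n j count such permutations when σ occupies positions p+1, …, p+n.  If σ
-- starts with v, then σ = v x y where x permutes {1..v-1} and y permutes {v+1..n}
-- (first-block-below / second-block-above, by pigeonhole); the descents add up, plus one
-- when x ≠ [], and the bound passes to x at offset p+1 and to y at offset p.  So for p ≤ k
-- the table count p k obeys a first-entry recursion whose child is count (p+1) k, and for
-- p > k only the empty word counts.  Such a recursion determines a table from its child
-- (recursion-unique).  Algebraically, tower 0 = δ and
-- tower (e+1) n j = Σ_{i ≤ j} C(n+i, 2j) · tower e j i obey the same recursion with child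
-- tower e (TransformStep: Pascal's rule and Vandermonde's convolution), so induction on
-- k - p gives count 0 k = tower (k+1); unfolding the chain sum along its last free entry
-- gives rhs k = tower (k+1).

open import Defs
open import Data.Bool using (Bool; true; false; _∧_; _∨_; not; T)
open import Data.Bool.Properties using (∨-assoc; ∧-assoc; ∧-comm; ∨-identityʳ; ∧-identityʳ; ∧-zeroʳ)
open import Data.Bool.ListAction using (all; any)
open import Data.Empty using (⊥; ⊥-elim)
open import Data.Unit using (tt)
open import Data.Nat using (ℕ; zero; suc; _+_; _*_; _∸_; _≤_; _<_; z≤n; s≤s; _≤ᵇ_; _<ᵇ_; _≡ᵇ_; _≤?_)
open import Data.Nat.Properties
open import Data.Nat.Combinatorics using (_C_; nCk+nC[k+1]≡[n+1]C[k+1]; k>n⇒nCk≡0)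
open import Data.Nat.ListAction using (sum)
open import Data.Nat.Tactic.RingSolver using (solve-∀)
open import Data.Product using (_×_; _,_; proj₁; proj₂; ∃)
open import Data.List using (List; []; _∷_; _++_; map; concatMap; length; applyUpTo; filterᵇ)
open import Data.List.Properties using (++-assoc; map-applyUpTo)
open import Data.List.Relation.Unary.All as All using (All; []; _∷_)
open import Data.List.Relation.Unary.All.Properties using (++⁻; ++⁺)
open import Data.List.Relation.Unary.Any using (Any; here; there)
open import Data.List.Membership.Propositional using (_∈_)
open import Data.List.Membership.Propositional.Properties using (∈-++⁺ˡ; ∈-++⁺ʳ)
open import Relation.Nullary using (yes; no)
open import Relation.Binary.PropositionalEquality using (_≡_; _≢_; refl; sym; trans; cong; cong₂; subst)
open Relation.Binary.PropositionalEquality.≡-Reasoning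

Σ< : ℕ → (ℕ → ℕ) → ℕ
Σ< zero    f = 0
Σ< (suc n) f = f 0 + Σ< n (λ i → f (suc i))

Σ-cong : ∀ n {f g : ℕ → ℕ} → (∀ i → i < n → f i ≡ g i) → Σ< n f ≡ Σ< n g
Σ-cong zero    eq = refl
Σ-cong (suc n) eq = cong₂ _+_ (eq 0 (s≤s z≤n)) (Σ-cong n (λ i i<n → eq (suc i) (s≤s i<n)))

Σ-ext : ∀ n {f g : ℕ → ℕ} → (∀ i → f i ≡ g i) → Σ< n f ≡ Σ< n g
Σ-ext n eq = Σ-cong n (λ i _ → eq i)

Σ-zero : ∀ n {f : ℕ → ℕ} → (∀ i → i < n → f i ≡ 0) → Σ< n f ≡ 0
Σ-zero n {f} vanish = trans (Σ-cong n vanish) (zeros n)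
  where
  zeros : ∀ n → Σ< n (λ _ → 0) ≡ 0
  zeros zero    = refl
  zeros (suc n) = zeros n

Σ-+ : ∀ n (f g : ℕ → ℕ) → Σ< n (λ i → f i + g i) ≡ Σ< n f + Σ< n g
Σ-+ zero    f g = refl
Σ-+ (suc n) f g = trans (cong (f 0 + g 0 +_) (Σ-+ n (λ i → f (suc i)) (λ i → g (suc i))))
                        (interchange (f 0) (g 0) _ _)
  where
  interchange : ∀ a b c d → (a + b) + (c + d) ≡ (a + c) + (b + d)
  interchange = solve-∀

Σ-*ˡ : ∀ n c (f : ℕ → ℕ) → Σ< n (λ i → c * f i) ≡ c * Σ< n f
Σ-*ˡ zero    c f = sym (*-zeroʳ c)
Σ-*ˡ (suc n) c f = trans (cong (c * f 0 +_) (Σ-*ˡ n c (λ i → f (suc i))))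
                         (sym (*-distribˡ-+ c (f 0) _))

Σ-*ʳ : ∀ n c (f : ℕ → ℕ) → Σ< n (λ i → f i * c) ≡ Σ< n f * c
Σ-*ʳ n c f = trans (Σ-ext n (λ i → *-comm (f i) c)) (trans (Σ-*ˡ n c f) (*-comm c _))

Σ-product : ∀ n k (f g : ℕ → ℕ) → Σ< n f * Σ< k g ≡ Σ< n (λ l → Σ< k (λ i → f l * g i))
Σ-product n k f g = trans (sym (Σ-*ʳ n (Σ< k g) f)) (Σ-ext n (λ l → sym (Σ-*ˡ k (f l) g)))

Σ-split : ∀ m n (f : ℕ → ℕ) → Σ< (m + n) f ≡ Σ< m f + Σ< n (λ i → f (m + i))
Σ-split zero    n f = refl
Σ-split (suc m) n f = trans (cong (f 0 +_) (Σ-split m n (λ i → f (suc i)))) (sym (+-assoc (f 0) _ _))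

Σ-last : ∀ n (f : ℕ → ℕ) → Σ< (suc n) f ≡ Σ< n f + f n
Σ-last n f = begin
  Σ< (suc n) f                    ≡⟨ cong (λ z → Σ< z f) (+-comm 1 n) ⟩
  Σ< (n + 1) f                    ≡⟨ Σ-split n 1 f ⟩
  Σ< n f + (f (n + 0) + 0)        ≡⟨ cong (Σ< n f +_) (trans (+-identityʳ _) (cong f (+-identityʳ n))) ⟩
  Σ< n f + f n                    ∎

Σ-swap : ∀ m n (f : ℕ → ℕ → ℕ) → Σ< m (λ i → Σ< n (f i)) ≡ Σ< n (λ j → Σ< m (λ i → f i j))
Σ-swap zero    n f = sym (Σ-zero n (λ _ _ → refl))
Σ-swap (suc m) n f = begin
  Σ< n (f 0) + Σ< m (λ i → Σ< n (f (suc i)))       ≡⟨ cong (Σ< n (f 0) +_) (Σ-swap m n (λ i → f (suc i))) ⟩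
  Σ< n (f 0) + Σ< n (λ j → Σ< m (λ i → f (suc i) j)) ≡⟨ sym (Σ-+ n (f 0) _) ⟩
  Σ< n (λ j → f 0 j + Σ< m (λ i → f (suc i) j))    ∎

Σ-extend : ∀ m n (f : ℕ → ℕ) → m ≤ n → (∀ i → m ≤ i → i < n → f i ≡ 0) → Σ< n f ≡ Σ< m f
Σ-extend m n f m≤n vanish = begin
  Σ< n f                                 ≡⟨ cong (λ z → Σ< z f) (sym (m+[n∸m]≡n m≤n)) ⟩
  Σ< (m + (n ∸ m)) f                     ≡⟨ Σ-split m (n ∸ m) f ⟩
  Σ< m f + Σ< (n ∸ m) (λ i → f (m + i))  ≡⟨ cong (Σ< m f +_) (Σ-zero (n ∸ m) tail-vanishes) ⟩
  Σ< m f + 0                             ≡⟨ +-identityʳ _ ⟩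
  Σ< m f                                 ∎
  where
  tail-vanishes : ∀ i → i < n ∸ m → f (m + i) ≡ 0
  tail-vanishes i i<n∸m = vanish (m + i) (m≤m+n m i)
    (subst (m + i <_) (m+[n∸m]≡n m≤n) (+-monoʳ-< m i<n∸m))

ΣL : {A : Set} → (A → ℕ) → List A → ℕ
ΣL F xs = sum (map F xs)

module _ {A : Set} where

  ΣL-++ : ∀ (F : A → ℕ) xs ys → ΣL F (xs ++ ys) ≡ ΣL F xs + ΣL F ys
  ΣL-++ F []       ys = refl
  ΣL-++ F (x ∷ xs) ys = trans (cong (F x +_) (ΣL-++ F xs ys)) (sym (+-assoc (F x) _ _))

  ΣL-ext : ∀ {F G : A → ℕ} xs → (∀ x → F x ≡ G x) → ΣL F xs ≡ ΣL G xs
  ΣL-ext []       eq = refl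
  ΣL-ext (x ∷ xs) eq = cong₂ _+_ (eq x) (ΣL-ext xs eq)

  ΣL-zero : ∀ (F : A → ℕ) xs → (∀ x → F x ≡ 0) → ΣL F xs ≡ 0
  ΣL-zero F []       eq = refl
  ΣL-zero F (x ∷ xs) eq = cong₂ _+_ (eq x) (ΣL-zero F xs eq)

  ΣL-*ˡ : ∀ (F : A → ℕ) K xs → ΣL (λ x → K * F x) xs ≡ K * ΣL F xs
  ΣL-*ˡ F K []       = sym (*-zeroʳ K)
  ΣL-*ˡ F K (x ∷ xs) = trans (cong (K * F x +_) (ΣL-*ˡ F K xs)) (sym (*-distribˡ-+ K (F x) _))

  ΣL-*ʳ : ∀ (F : A → ℕ) K xs → ΣL (λ x → F x * K) xs ≡ ΣL F xs * K
  ΣL-*ʳ F K xs = trans (ΣL-ext xs (λ x → *-comm (F x) K)) (trans (ΣL-*ˡ F K xs) (*-comm K _))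

  ΣL-Σ : ∀ n (G : ℕ → A → ℕ) xs → ΣL (λ x → Σ< n (λ a → G a x)) xs ≡ Σ< n (λ a → ΣL (G a) xs)
  ΣL-Σ n G []       = sym (Σ-zero n (λ _ _ → refl))
  ΣL-Σ n G (x ∷ xs) = trans (cong (Σ< n (λ a → G a x) +_) (ΣL-Σ n G xs)) (sym (Σ-+ n (λ a → G a x) _))

module _ {A B : Set} where

  ΣL-map : ∀ (F : B → ℕ) (g : A → B) xs → ΣL F (map g xs) ≡ ΣL (λ x → F (g x)) xs
  ΣL-map F g []       = refl
  ΣL-map F g (x ∷ xs) = cong (F (g x) +_) (ΣL-map F g xs)

  ΣL-concatMap : ∀ (F : B → ℕ) (g : A → List B) xs → ΣL F (concatMap g xs) ≡ ΣL (λ x → ΣL F (g x)) xs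
  ΣL-concatMap F g []       = refl
  ΣL-concatMap F g (x ∷ xs) = trans (ΣL-++ F (g x) (concatMap g xs)) (cong (ΣL F (g x) +_) (ΣL-concatMap F g xs))

ΣL-applyUpTo : ∀ {A : Set} (F : A → ℕ) (h : ℕ → A) n → ΣL F (applyUpTo h n) ≡ Σ< n (λ t → F (h t))
ΣL-applyUpTo F h zero    = refl
ΣL-applyUpTo F h (suc n) = cong (F (h 0) +_) (ΣL-applyUpTo F (λ t → h (suc t)) n)

ι : Bool → ℕ
ι true  = 1
ι false = 0

ι-∧ : ∀ a b → ι (a ∧ b) ≡ ι a * ι b
ι-∧ true  b = sym (+-identityʳ (ι b))
ι-∧ false b = refl

ι-≤ : ∀ {a b} → a ≤ b → ι (a ≤ᵇ b) ≡ 1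
ι-≤ {a} {b} a≤b with a ≤ᵇ b | ≤⇒≤ᵇ a≤b
... | true | _ = refl

ι-≰ : ∀ {a b} → b < a → ι (a ≤ᵇ b) ≡ 0
ι-≰ {a} {b} b<a with a ≤ᵇ b in eq
... | false = refl
... | true  = ⊥-elim (<⇒≱ b<a (≤ᵇ⇒≤ a b (subst T (sym eq) tt)))

Σ-triangle : ∀ D (ψ : ℕ → ℕ → ℕ) →
  Σ< D (λ t → Σ< (suc t) (λ s → ψ s t)) ≡ Σ< D (λ s → Σ< (D ∸ s) (λ t → ψ s (s + t)))
Σ-triangle D ψ = begin
  Σ< D (λ t → Σ< (suc t) (λ s → ψ s t))     ≡⟨ Σ-cong D (λ t t<D → sym (trans (Σ-extend (suc t) D (ψ≤ t) t<D (upper t))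
                                                  (Σ-cong (suc t) (λ s s≤t → lower t s (≤-pred s≤t))))) ⟩
  Σ< D (λ t → Σ< D (λ s → ψ≤ t s))          ≡⟨ Σ-swap D D ψ≤ ⟩
  Σ< D (λ s → Σ< D (λ t → ψ≤ t s))          ≡⟨ Σ-cong D row ⟩
  Σ< D (λ s → Σ< (D ∸ s) (λ t → ψ s (s + t))) ∎
  where
  ψ≤ : ℕ → ℕ → ℕ
  ψ≤ t s = ι (s ≤ᵇ t) * ψ s t
  lower : ∀ t s → s ≤ t → ψ≤ t s ≡ ψ s t
  lower t s s≤t = trans (cong (_* ψ s t) (ι-≤ s≤t)) (*-identityˡ _)
  upper : ∀ t s → suc t ≤ s → s < D → ψ≤ t s ≡ 0
  upper t s t<s _ = cong (_* ψ s t) (ι-≰ t<s)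
  diagonal : ∀ s t → ψ≤ (s + t) s ≡ ψ s (s + t)
  diagonal s t = lower (s + t) s (m≤m+n s t)
  row : ∀ s → s < D → Σ< D (λ t → ψ≤ t s) ≡ Σ< (D ∸ s) (λ t → ψ s (s + t))
  row s s<D = begin
    Σ< D (λ t → ψ≤ t s)                     ≡⟨ cong (λ z → Σ< z (λ t → ψ≤ t s)) (sym (m+[n∸m]≡n (<⇒≤ s<D))) ⟩
    Σ< (s + (D ∸ s)) (λ t → ψ≤ t s)         ≡⟨ Σ-split s (D ∸ s) (λ t → ψ≤ t s) ⟩
    Σ< s (λ t → ψ≤ t s) + Σ< (D ∸ s) (λ t → ψ≤ (s + t) s)
      ≡⟨ cong₂ _+_ (Σ-zero s (λ t t<s → cong (_* ψ s t) (ι-≰ t<s))) (Σ-ext (D ∸ s) (diagonal s)) ⟩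
    Σ< (D ∸ s) (λ t → ψ s (s + t))          ∎

vandermonde : ∀ N A B → Σ< (suc N) (λ p → (p C A) * ((N ∸ p) C B)) ≡ (suc N) C suc (A + B)
vandermonde zero    zero    zero          = refl
vandermonde zero    zero    (suc zero)    = refl
vandermonde zero    zero    (suc (suc B)) = refl
vandermonde zero    (suc A) B             = refl
vandermonde (suc N) A zero = begin
  Σ< (suc (suc N)) (λ p → (p C A) * ((suc N ∸ p) C 0))
    ≡⟨ Σ-last (suc N) (λ p → (p C A) * ((suc N ∸ p) C 0)) ⟩
  Σ< (suc N) (λ p → (p C A) * ((suc N ∸ p) C 0)) + (suc N C A) * ((suc N ∸ suc N) C 0)
    ≡⟨ cong₂ _+_ (vandermonde N A 0) (*-identityʳ (suc N C A)) ⟩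
  suc N C suc (A + 0) + suc N C A
    ≡⟨ cong (λ t → suc N C suc t + suc N C A) (+-identityʳ A) ⟩
  suc N C suc A + suc N C A
    ≡⟨ +-comm (suc N C suc A) _ ⟩
  suc N C A + suc N C suc A
    ≡⟨ nCk+nC[k+1]≡[n+1]C[k+1] (suc N) A ⟩
  suc (suc N) C suc A
    ≡⟨ cong (λ t → suc (suc N) C suc t) (sym (+-identityʳ A)) ⟩
  suc (suc N) C suc (A + 0) ∎
vandermonde (suc N) A (suc B) = begin
  Σ< (suc (suc N)) (λ p → (p C A) * ((suc N ∸ p) C suc B))
    ≡⟨ Σ-last (suc N) (λ p → (p C A) * ((suc N ∸ p) C suc B)) ⟩
  Σ< (suc N) (λ p → (p C A) * ((suc N ∸ p) C suc B)) + (suc N C A) * ((suc N ∸ suc N) C suc B)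
    ≡⟨ cong₂ _+_ (Σ-cong (suc N) pascal-term) last-vanishes ⟩
  Σ< (suc N) (λ p → (p C A) * ((N ∸ p) C B) + (p C A) * ((N ∸ p) C suc B)) + 0
    ≡⟨ +-identityʳ _ ⟩
  Σ< (suc N) (λ p → (p C A) * ((N ∸ p) C B) + (p C A) * ((N ∸ p) C suc B))
    ≡⟨ Σ-+ (suc N) (λ p → (p C A) * ((N ∸ p) C B)) (λ p → (p C A) * ((N ∸ p) C suc B)) ⟩
  Σ< (suc N) (λ p → (p C A) * ((N ∸ p) C B)) + Σ< (suc N) (λ p → (p C A) * ((N ∸ p) C suc B))
    ≡⟨ cong₂ _+_ (vandermonde N A B) (vandermonde N A (suc B)) ⟩
  suc N C suc (A + B) + suc N C suc (A + suc B)
    ≡⟨ cong (λ t → suc N C suc (A + B) + suc N C suc t) (+-suc A B) ⟩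
  suc N C suc (A + B) + suc N C suc (suc (A + B))
    ≡⟨ nCk+nC[k+1]≡[n+1]C[k+1] (suc N) (suc (A + B)) ⟩
  suc (suc N) C suc (suc (A + B))
    ≡⟨ cong (λ t → suc (suc N) C suc t) (sym (+-suc A B)) ⟩
  suc (suc N) C suc (A + suc B) ∎
  where
  pascal-term : ∀ p → p < suc N →
    (p C A) * ((suc N ∸ p) C suc B) ≡ (p C A) * ((N ∸ p) C B) + (p C A) * ((N ∸ p) C suc B)
  pascal-term p (s≤s p≤N) rewrite +-∸-assoc 1 p≤N =
    trans (cong ((p C A) *_) (sym (nCk+nC[k+1]≡[n+1]C[k+1] (N ∸ p) B))) (*-distribˡ-+ (p C A) _ _)
  last-vanishes : (suc N C A) * ((suc N ∸ suc N) C suc B) ≡ 0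
  last-vanishes = trans (cong (λ t → (suc N C A) * (t C suc B)) (n∸n≡0 N)) (*-zeroʳ (suc N C A))

-- Vandermonde with both upper indices shifted:
-- Σ_{u ≤ m} C(u+l, A) C(m-u+i, B) = C(m+l+i+1, A+B+1) when l ≤ A and i ≤ B, because the
-- omitted terms of the full convolution (p < l or p > l+m) vanish.
vandermonde-shifted : ∀ m l i A B → l ≤ A → i ≤ B →
  Σ< (suc m) (λ u → ((u + l) C A) * (((m ∸ u) + i) C B)) ≡ suc (m + l + i) C suc (A + B)
vandermonde-shifted m l i A B l≤A i≤B = begin
  Σ< (suc m) (λ u → ((u + l) C A) * (((m ∸ u) + i) C B))
    ≡⟨ sym (Σ-cong (suc m) middle) ⟩
  Σ< (suc m) (λ u → F (l + u))
    ≡⟨ sym (+-identityʳ _) ⟩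
  Σ< (suc m) (λ u → F (l + u)) + 0
    ≡⟨ cong (Σ< (suc m) (λ u → F (l + u)) +_) (sym (Σ-zero i top)) ⟩
  Σ< (suc m) (λ u → F (l + u)) + Σ< i (λ r → F (l + (suc m + r)))
    ≡⟨ sym (Σ-split (suc m) i (λ q → F (l + q))) ⟩
  Σ< (suc m + i) (λ q → F (l + q))
    ≡⟨ cong (_+ Σ< (suc m + i) (λ q → F (l + q))) (sym (Σ-zero l bottom)) ⟩
  Σ< l F + Σ< (suc m + i) (λ q → F (l + q))
    ≡⟨ sym (Σ-split l (suc m + i) F) ⟩
  Σ< (l + (suc m + i)) F
    ≡⟨ cong (λ t → Σ< t F) (+-suc l (m + i)) ⟩
  Σ< (suc N) F
    ≡⟨ vandermonde N A B ⟩
  suc N C suc (A + B)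
    ≡⟨ cong (λ t → suc t C suc (A + B)) (trans (sym (+-assoc l m i)) (cong (_+ i) (+-comm l m))) ⟩
  suc (m + l + i) C suc (A + B) ∎
  where
  N = l + (m + i)
  F : ℕ → ℕ
  F p = (p C A) * ((N ∸ p) C B)
  bottom : ∀ p → p < l → F p ≡ 0
  bottom p p<l = cong (_* ((N ∸ p) C B)) (k>n⇒nCk≡0 (<-≤-trans p<l l≤A))
  top : ∀ r → r < i → F (l + (suc m + r)) ≡ 0
  top r r<i = trans (cong (λ t → ((l + (suc m + r)) C A) * (t C B)) rest)
                    (trans (cong (((l + (suc m + r)) C A) *_) (k>n⇒nCk≡0 small)) (*-zeroʳ ((l + (suc m + r)) C A)))
    where
    rest : N ∸ (l + (suc m + r)) ≡ i ∸ suc r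
    rest = trans ([m+n]∸[m+o]≡n∸o l (m + i) (suc m + r))
                 (trans (cong ((m + i) ∸_) (sym (+-suc m r))) ([m+n]∸[m+o]≡n∸o m i (suc r)))
    small : i ∸ suc r < B
    small = <-≤-trans (∸-monoʳ-< {i} {suc r} {0} (s≤s z≤n) r<i) i≤B
  middle : ∀ u → u < suc m → F (l + u) ≡ ((u + l) C A) * (((m ∸ u) + i) C B)
  middle u (s≤s u≤m) = cong₂ (λ a b → (a C A) * (b C B)) (+-comm l u)
    (trans ([m+n]∸[m+o]≡n∸o l (m + i) u) (+-∸-comm i u≤m))

-- Tables h n j (n = length, j = number of descents).  δ is the table of the empty word.
δ : ℕ → ℕ → ℕ
δ zero    zero    = 1
δ zero    (suc j) = 0
δ (suc n) j       = 0

transform : (ℕ → ℕ → ℕ) → ℕ → ℕ → ℕ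
transform f n j = Σ< (suc j) (λ i → ((n + i) C (2 * j)) * f j i)

tower : ℕ → ℕ → ℕ → ℕ
tower zero    = δ
tower (suc e) = transform (tower e)

-- Two descent tables glued by one extra descent: Σ_{a + b + 1 = j} F a · G b.
glue : (ℕ → ℕ) → (ℕ → ℕ) → ℕ → ℕ
glue F G zero    = 0
glue F G (suc J) = Σ< (suc J) (λ a → F a * G (J ∸ a))

glue-cong : ∀ {F F′ G G′} j → (∀ a → F a ≡ F′ a) → (∀ b → G b ≡ G′ b) → glue F G j ≡ glue F′ G′ j
glue-cong zero    eqF eqG = refl
glue-cong (suc J) eqF eqG = Σ-ext (suc J) (λ a → cong₂ _*_ (eqF a) (eqG (J ∸ a)))

glue-zero : ∀ F G j → (∀ a → F a ≡ 0) → glue F G j ≡ 0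
glue-zero F G zero    _ = refl
glue-zero F G (suc J) F≡0 = Σ-zero (suc J) (λ a _ → cong (_* G (J ∸ a)) (F≡0 a))

-- Contribution of the words of length m+1 whose first entry is u+2 ≥ 2: that entry is a
-- descent top, followed by a block of length u+1 counted by the child table f and a block
-- of length m-u-1 counted by h.
branch : (ℕ → ℕ → ℕ) → (ℕ → ℕ → ℕ) → ℕ → ℕ → ℕ
branch f h m j = Σ< m (λ u → glue (f (suc u)) (h (m ∸ suc u)) j)

-- No word has a negative number of descents, so nothing is glued at j = 0.
branch-zero : ∀ f h m → branch f h m 0 ≡ 0
branch-zero f h m = Σ-zero m (λ _ _ → refl)

-- h obeys the first-entry recursion with child table f (a first entry 1 adds no descent).
record FirstEntryRecursion (f h : ℕ → ℕ → ℕ) : Set where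
  field
    empty       : ∀ j → h 0 j ≡ δ 0 j
    first-entry : ∀ m j → h (suc m) j ≡ h m j + branch f h m j
open FirstEntryRecursion

Triangular : (ℕ → ℕ → ℕ) → Set
Triangular f = ∀ n j → n < j → f n j ≡ 0

branch-cong : ∀ f f′ h h′ m j → (∀ n i → f (suc n) i ≡ f′ (suc n) i) → (∀ n i → n < m → h n i ≡ h′ n i) →
  branch f h m j ≡ branch f′ h′ m j
branch-cong f f′ h h′ m j eqf eqh = Σ-cong m (λ u u<m →
  glue-cong j (eqf u) (λ b → eqh (m ∸ suc u) b (∸-monoʳ-< {m} {suc u} {0} (s≤s z≤n) u<m)))

recursion-unique : ∀ {f f′ h h′} → (∀ n i → f n i ≡ f′ n i) →
  FirstEntryRecursion f h → FirstEntryRecursion f′ h′ → ∀ n j → h n j ≡ h′ n j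
recursion-unique {f} {f′} {h} {h′} eqf r r′ n j = below (suc n) n j ≤-refl
  where
  below : ∀ N n j → n < N → h n j ≡ h′ n j
  below (suc N) zero    j _         = trans (empty r j) (sym (empty r′ j))
  below (suc N) (suc m) j (s≤s m<N) = begin
    h (suc m) j                  ≡⟨ first-entry r m j ⟩
    h m j + branch f h m j       ≡⟨ cong₂ _+_ (below N m j m<N)
                                      (branch-cong f f′ h h′ m j (λ n i → eqf (suc n) i)
                                        (λ n i n<m → below N n i (<-≤-trans n<m (<⇒≤ m<N)))) ⟩
    h′ m j + branch f′ h′ m j    ≡⟨ sym (first-entry r′ m j) ⟩
    h′ (suc m) j                 ∎

δ-triangular : Triangular δ
δ-triangular zero    (suc j) _ = refl
δ-triangular (suc n) j       _ = refl

transform-triangular : ∀ f → Triangular (transform f)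
transform-triangular f n j n<j = Σ-zero (suc j) (λ i i≤j → cong (_* f j i) (k>n⇒nCk≡0 (short i (≤-pred i≤j))))
  where
  short : ∀ i → i ≤ j → n + i < 2 * j
  short i i≤j = subst (n + i <_) (cong (j +_) (sym (+-identityʳ j))) (+-mono-<-≤ n<j i≤j)

tower-triangular : ∀ e → Triangular (tower e)
tower-triangular zero    = δ-triangular
tower-triangular (suc e) = transform-triangular (tower e)

tower-00 : ∀ e → tower e 0 0 ≡ 1
tower-00 zero    = refl
tower-00 (suc e) = trans (+-identityʳ _) (trans (*-identityˡ _) (tower-00 e))

tower-1 : ∀ n j → tower 1 n j ≡ δ 0 j
tower-1 n zero    = refl
tower-1 n (suc j) = Σ-zero (suc (suc j)) (λ i _ → *-zeroʳ ((n + i) C (2 * suc j)))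

double-suc : ∀ J → 2 * suc J ≡ suc (suc (2 * J))
double-suc = solve-∀

module TransformStep (f : ℕ → ℕ → ℕ) (rec : FirstEntryRecursion f (transform f))
                     (f-tri : Triangular f) (f00 : f 0 0 ≡ 1) where

  g h : ℕ → ℕ → ℕ
  g = transform f
  h = transform g

  -- Both sides are expanded into a triple sum over
  -- a ≤ J (descents of the first block), l ≤ a and i ≤ J - a; the u-sum of the branch
  -- becomes a Vandermonde convolution once its missing u = 0 term is added, and the left
  -- side is unfolded with the recursion of g.
  module KeyIdentity (m J : ℕ) where

    -- The binomial coefficients produced by expanding g (u+1) a and h (m-u-1) (J-a).
    kernel : ℕ → ℕ → ℕ → ℕ → ℕ
    kernel a l i u = ((u + l) C (2 * a)) * (((m ∸ u) + i) C (2 * (J ∸ a)))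

    weight : ℕ → ℕ → ℕ → ℕ
    weight a l i = f a l * g (J ∸ a) i

    Σ³ : (ℕ → ℕ → ℕ → ℕ) → ℕ
    Σ³ φ = Σ< (suc J) (λ a → Σ< (suc a) (λ l → Σ< (suc (J ∸ a)) (φ a l)))

    Σ³-+ : ∀ φ ψ → Σ³ (λ a l i → φ a l i + ψ a l i) ≡ Σ³ φ + Σ³ ψ
    Σ³-+ φ ψ = trans (Σ-ext (suc J) (λ a → trans (Σ-ext (suc a) (λ l → Σ-+ (suc (J ∸ a)) (φ a l) (ψ a l)))
                       (Σ-+ (suc a) (λ l → Σ< (suc (J ∸ a)) (φ a l)) (λ l → Σ< (suc (J ∸ a)) (ψ a l)))))
                     (Σ-+ (suc J) (λ a → Σ< (suc a) (λ l → Σ< (suc (J ∸ a)) (φ a l)))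
                                  (λ a → Σ< (suc a) (λ l → Σ< (suc (J ∸ a)) (ψ a l))))

    Σ³-cong : ∀ φ ψ → (∀ a l i → a ≤ J → l ≤ a → i ≤ J ∸ a → φ a l i ≡ ψ a l i) → Σ³ φ ≡ Σ³ ψ
    Σ³-cong φ ψ eq = Σ-cong (suc J) (λ a a≤J → Σ-cong (suc a) (λ l l≤a →
                       Σ-cong (suc (J ∸ a)) (λ i i≤ → eq a l i (≤-pred a≤J) (≤-pred l≤a) (≤-pred i≤))))

    branch-expanded : branch g h m (suc J) ≡ Σ³ (λ a l i → weight a l i * Σ< m (λ u → kernel a l i (suc u)))
    branch-expanded = begin
      Σ< m (λ u → Σ< (suc J) (λ a → g (suc u) a * h (m ∸ suc u) (J ∸ a)))
        ≡⟨ Σ-ext m (λ u → Σ-ext (suc J) (λ a → trans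
              (Σ-product (suc a) (suc (J ∸ a)) (λ l → ((suc u + l) C (2 * a)) * f a l)
                         (λ i → (((m ∸ suc u) + i) C (2 * (J ∸ a))) * g (J ∸ a) i))
              (Σ-ext (suc a) (λ l → Σ-ext (suc (J ∸ a)) (λ i →
                 regroup ((suc u + l) C (2 * a)) (f a l) (((m ∸ suc u) + i) C (2 * (J ∸ a))) (g (J ∸ a) i)))))) ⟩
      Σ< m (λ u → Σ< (suc J) (λ a → Σ< (suc a) (λ l → Σ< (suc (J ∸ a)) (λ i → weight a l i * kernel a l i (suc u)))))
        ≡⟨ Σ-swap m (suc J) (λ u a → Σ< (suc a) (λ l → Σ< (suc (J ∸ a)) (λ i → weight a l i * kernel a l i (suc u)))) ⟩
      Σ< (suc J) (λ a → Σ< m (λ u → Σ< (suc a) (λ l → Σ< (suc (J ∸ a)) (λ i → weight a l i * kernel a l i (suc u)))))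
        ≡⟨ Σ-ext (suc J) (λ a → trans (Σ-swap m (suc a) (λ u l → Σ< (suc (J ∸ a)) (λ i → weight a l i * kernel a l i (suc u))))
             (Σ-ext (suc a) (λ l → trans (Σ-swap m (suc (J ∸ a)) (λ u i → weight a l i * kernel a l i (suc u)))
               (Σ-ext (suc (J ∸ a)) (λ i → Σ-*ˡ m (weight a l i) (λ u → kernel a l i (suc u))))))) ⟩
      Σ³ (λ a l i → weight a l i * Σ< m (λ u → kernel a l i (suc u))) ∎
      where
      regroup : ∀ c₁ x c₂ y → (c₁ * x) * (c₂ * y) ≡ (x * y) * (c₁ * c₂)
      regroup = solve-∀

    -- Adding the u = 0 terms turns each u-sum into a shifted Vandermonde convolution.
    missing : ℕ
    missing = Σ³ (λ a l i → weight a l i * kernel a l i 0)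

    completed : ℕ
    completed = Σ³ (λ a l i → weight a l i * (suc (m + l + i) C suc (2 * J)))

    branch-completed : branch g h m (suc J) + missing ≡ completed
    branch-completed = begin
      branch g h m (suc J) + missing
        ≡⟨ cong (_+ missing) branch-expanded ⟩
      Σ³ (λ a l i → weight a l i * Σ< m (λ u → kernel a l i (suc u))) + missing
        ≡⟨ sym (Σ³-+ (λ a l i → weight a l i * Σ< m (λ u → kernel a l i (suc u))) (λ a l i → weight a l i * kernel a l i 0)) ⟩
      Σ³ (λ a l i → weight a l i * Σ< m (λ u → kernel a l i (suc u)) + weight a l i * kernel a l i 0)
        ≡⟨ Σ³-cong _ _ convolve ⟩
      completed ∎
      where
      convolve : ∀ a l i → a ≤ J → l ≤ a → i ≤ J ∸ a →
        weight a l i * Σ< m (λ u → kernel a l i (suc u)) + weight a l i * kernel a l i 0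
          ≡ weight a l i * (suc (m + l + i) C suc (2 * J))
      convolve a l i a≤J l≤a i≤ = begin
        weight a l i * Σ< m (λ u → kernel a l i (suc u)) + weight a l i * kernel a l i 0
          ≡⟨ +-comm (weight a l i * Σ< m (λ u → kernel a l i (suc u))) _ ⟩
        weight a l i * kernel a l i 0 + weight a l i * Σ< m (λ u → kernel a l i (suc u))
          ≡⟨ sym (*-distribˡ-+ (weight a l i) _ _) ⟩
        weight a l i * Σ< (suc m) (kernel a l i)
          ≡⟨ cong (weight a l i *_) (vandermonde-shifted m l i (2 * a) (2 * (J ∸ a))
                                        (≤-trans l≤a (m≤m+n a _)) (≤-trans i≤ (m≤m+n (J ∸ a) _))) ⟩
        weight a l i * (suc (m + l + i) C suc (2 * a + 2 * (J ∸ a)))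
          ≡⟨ cong (λ t → weight a l i * (suc (m + l + i) C suc t))
                  (trans (sym (*-distribˡ-+ 2 a (J ∸ a))) (cong (2 *_) (m+[n∸m]≡n a≤J))) ⟩
        weight a l i * (suc (m + l + i) C suc (2 * J)) ∎

    against-g : (ℕ → ℕ) → ℕ
    against-g c = Σ< (suc J) (λ i → g J i * c i)

    -- Only a = l = 0 survives in the missing term, since C(l, 2a) = 0 for 0 < a and l ≤ a.
    missing-value : missing ≡ against-g (λ i → (m + i) C (2 * J))
    missing-value = begin
      missing
        ≡⟨ cong (Σ< 1 (λ l → Σ< (suc J) (λ i → weight 0 l i * kernel 0 l i 0)) +_) (Σ-zero J positive-a) ⟩
      Σ< 1 (λ l → Σ< (suc J) (λ i → weight 0 l i * kernel 0 l i 0)) + 0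
        ≡⟨ trans (+-identityʳ _) (+-identityʳ _) ⟩
      Σ< (suc J) (λ i → (f 0 0 * g J i) * (1 * ((m + i) C (2 * J))))
        ≡⟨ Σ-ext (suc J) (λ i → cong₂ _*_ (trans (cong (_* g J i) f00) (+-identityʳ (g J i))) (*-identityˡ ((m + i) C (2 * J)))) ⟩
      against-g (λ i → (m + i) C (2 * J)) ∎
      where
      positive-a : ∀ a → a < J →
        Σ< (suc (suc a)) (λ l → Σ< (suc (J ∸ suc a)) (λ i → weight (suc a) l i * kernel (suc a) l i 0)) ≡ 0
      positive-a a _ = Σ-zero (suc (suc a)) (λ l l≤ → Σ-zero (suc (J ∸ suc a)) (λ i _ →
        trans (cong (λ t → weight (suc a) l i * (t * ((m + i) C (2 * (J ∸ suc a))))) (k>n⇒nCk≡0 (short l (≤-pred l≤))))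
              (*-zeroʳ (weight (suc a) l i))))
        where
        short : ∀ l → l ≤ suc a → l < 2 * suc a
        short l l≤ = subst (l <_) (sym (double-suc a)) (s≤s (≤-trans l≤ (s≤s (m≤m+n a (a + 0)))))

    completed-rest : ℕ
    completed-rest = Σ< J (λ w → Σ< (suc (suc w)) (λ l → Σ< (suc (J ∸ suc w)) (λ i →
                       weight (suc w) l i * (suc (m + l + i) C suc (2 * J)))))

    completed-split : completed ≡ against-g (λ i → suc (m + i) C suc (2 * J)) + completed-rest
    completed-split = cong (_+ completed-rest) (trans (+-identityʳ _) (Σ-ext (suc J) (λ i →
      cong₂ _*_ (trans (cong (_* g J i) f00) (+-identityʳ (g J i)))
                (cong (λ t → suc (t + i) C suc (2 * J)) (+-identityʳ m)))))

    lhs : ℕ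
    lhs = Σ< (suc (suc J)) (λ i → ((m + i) C suc (2 * J)) * g (suc J) i)

    lhs-old : ℕ
    lhs-old = Σ< (suc J) (λ i → ((m + i) C suc (2 * J)) * g J i)

    lhs-new : ℕ
    lhs-new = Σ< (suc (suc J)) (λ i → ((m + i) C suc (2 * J)) * branch f g J i)

    -- Unfold g (J+1) i by the recursion of g; the i = J+1 term of the old part vanishes.
    lhs-split : lhs ≡ lhs-old + lhs-new
    lhs-split = begin
      lhs
        ≡⟨ Σ-ext (suc (suc J)) (λ i → trans (cong (((m + i) C suc (2 * J)) *_) (first-entry rec J i))
             (*-distribˡ-+ ((m + i) C suc (2 * J)) (g J i) (branch f g J i))) ⟩
      Σ< (suc (suc J)) (λ i → ((m + i) C suc (2 * J)) * g J i + ((m + i) C suc (2 * J)) * branch f g J i)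
        ≡⟨ Σ-+ (suc (suc J)) (λ i → ((m + i) C suc (2 * J)) * g J i) (λ i → ((m + i) C suc (2 * J)) * branch f g J i) ⟩
      Σ< (suc (suc J)) (λ i → ((m + i) C suc (2 * J)) * g J i) + lhs-new
        ≡⟨ cong (_+ lhs-new) (trans (Σ-last (suc J) (λ i → ((m + i) C suc (2 * J)) * g J i))
             (trans (cong (lhs-old +_) (trans (cong (((m + suc J) C suc (2 * J)) *_) (transform-triangular f J (suc J) ≤-refl))
                                                 (*-zeroʳ ((m + suc J) C suc (2 * J)))))
                    (+-identityʳ _))) ⟩
      lhs-old + lhs-new ∎

    c : ℕ → ℕ
    c t = (m + suc t) C suc (2 * J)

    -- For fixed first-block length w+1, the triangle Σ_{t ≤ J} Σ_{s ≤ t} is reindexed by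
    -- (s, t - s) and truncated using triangularity of f (s ≤ w+1) and of g (t - s ≤ J-w-1).
    lhs-new-block : ∀ w → w < J →
      Σ< (suc J) (λ t → Σ< (suc t) (λ s → c t * (f (suc w) s * g (J ∸ suc w) (t ∸ s))))
        ≡ Σ< (suc (suc w)) (λ l → Σ< (suc (J ∸ suc w)) (λ i → weight (suc w) l i * (suc (m + l + i) C suc (2 * J))))
    lhs-new-block w w<J = begin
      Σ< (suc J) (λ t → Σ< (suc t) (λ s → c t * (F s * G (t ∸ s))))
        ≡⟨ Σ-triangle (suc J) (λ s t → c t * (F s * G (t ∸ s))) ⟩
      Σ< (suc J) (λ s → Σ< (suc J ∸ s) (λ t → c (s + t) * (F s * G ((s + t) ∸ s))))
        ≡⟨ Σ-cong (suc J) (λ s s≤J → trans (cong (λ z → Σ< z (λ t → c (s + t) * (F s * G ((s + t) ∸ s)))) (+-∸-assoc 1 (≤-pred s≤J)))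
                                              (Σ-ext (suc (J ∸ s)) (λ t → cong (λ z → c (s + t) * (F s * G z)) (m+n∸m≡n s t)))) ⟩
      Σ< (suc J) (λ s → Σ< (suc (J ∸ s)) (φ s))
        ≡⟨ Σ-extend (suc (suc w)) (suc J) (λ s → Σ< (suc (J ∸ s)) (φ s)) (s≤s w<J)
             (λ s w+1<s _ → Σ-zero (suc (J ∸ s)) (λ t _ →
                trans (cong (λ z → c (s + t) * (z * G t)) (f-tri (suc w) s w+1<s)) (*-zeroʳ (c (s + t))))) ⟩
      Σ< (suc (suc w)) (λ s → Σ< (suc (J ∸ s)) (φ s))
        ≡⟨ Σ-cong (suc (suc w)) (λ s s≤ → Σ-extend (suc (J ∸ suc w)) (suc (J ∸ s)) (φ s)
              (s≤s (∸-monoʳ-≤ J (≤-pred s≤)))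
              (λ t big _ → trans (cong (λ z → c (s + t) * (F s * z)) (transform-triangular f (J ∸ suc w) t big))
                 (trans (cong (c (s + t) *_) (*-zeroʳ (F s))) (*-zeroʳ (c (s + t)))))) ⟩
      Σ< (suc (suc w)) (λ l → Σ< (suc (J ∸ suc w)) (φ l))
        ≡⟨ Σ-ext (suc (suc w)) (λ l → Σ-ext (suc (J ∸ suc w)) (λ i →
              trans (*-comm (c (l + i)) (F l * G i))
                (cong (λ t → (F l * G i) * (t C suc (2 * J))) (trans (+-suc m (l + i)) (cong suc (sym (+-assoc m l i))))))) ⟩
      Σ< (suc (suc w)) (λ l → Σ< (suc (J ∸ suc w)) (λ i → weight (suc w) l i * (suc (m + l + i) C suc (2 * J)))) ∎
      where
      F G : ℕ → ℕ
      F = f (suc w)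
      G = g (J ∸ suc w)
      φ : ℕ → ℕ → ℕ
      φ s t = c (s + t) * (F s * G t)

    lhs-new-value : lhs-new ≡ completed-rest
    lhs-new-value = begin
      lhs-new
        ≡⟨ cong (_+ Σ< (suc J) (λ t → c t * branch f g J (suc t)))
                (trans (cong (((m + 0) C suc (2 * J)) *_) (branch-zero f g J)) (*-zeroʳ ((m + 0) C suc (2 * J)))) ⟩
      Σ< (suc J) (λ t → c t * Σ< J (λ w → Σ< (suc t) (λ s → f (suc w) s * g (J ∸ suc w) (t ∸ s))))
        ≡⟨ Σ-ext (suc J) (λ t → trans (sym (Σ-*ˡ J (c t) (λ w → Σ< (suc t) (λ s → f (suc w) s * g (J ∸ suc w) (t ∸ s)))))
              (Σ-ext J (λ w → sym (Σ-*ˡ (suc t) (c t) (λ s → f (suc w) s * g (J ∸ suc w) (t ∸ s)))))) ⟩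
      Σ< (suc J) (λ t → Σ< J (λ w → Σ< (suc t) (λ s → c t * (f (suc w) s * g (J ∸ suc w) (t ∸ s)))))
        ≡⟨ Σ-swap (suc J) J (λ t w → Σ< (suc t) (λ s → c t * (f (suc w) s * g (J ∸ suc w) (t ∸ s)))) ⟩
      Σ< J (λ w → Σ< (suc J) (λ t → Σ< (suc t) (λ s → c t * (f (suc w) s * g (J ∸ suc w) (t ∸ s)))))
        ≡⟨ Σ-cong J lhs-new-block ⟩
      completed-rest ∎

    pascal-sum : against-g (λ i → suc (m + i) C suc (2 * J)) ≡ against-g (λ i → (m + i) C (2 * J)) + lhs-old
    pascal-sum = trans (Σ-ext (suc J) (λ i → trans (cong (g J i *_) (sym (nCk+nC[k+1]≡[n+1]C[k+1] (m + i) (2 * J))))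
                         (trans (*-distribˡ-+ (g J i) ((m + i) C (2 * J)) _)
                           (cong (g J i * ((m + i) C (2 * J)) +_) (*-comm (g J i) _)))))
                       (Σ-+ (suc J) (λ i → g J i * ((m + i) C (2 * J))) (λ i → ((m + i) C suc (2 * J)) * g J i))

    -- lhs + missing and branch + missing both equal the completed sum.
    key : lhs ≡ branch g h m (suc J)
    key = +-cancelʳ-≡ missing lhs (branch g h m (suc J)) (begin
      lhs + missing
        ≡⟨ cong₂ _+_ (trans lhs-split (cong (lhs-old +_) lhs-new-value)) missing-value ⟩
      (lhs-old + completed-rest) + against-g (λ i → (m + i) C (2 * J))
        ≡⟨ rotate lhs-old completed-rest _ ⟩
      (against-g (λ i → (m + i) C (2 * J)) + lhs-old) + completed-rest
        ≡⟨ cong (_+ completed-rest) (sym pascal-sum) ⟩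
      against-g (λ i → suc (m + i) C suc (2 * J)) + completed-rest
        ≡⟨ sym completed-split ⟩
      completed
        ≡⟨ sym branch-completed ⟩
      branch g h m (suc J) + missing ∎)
      where
      rotate : ∀ a b c → (a + b) + c ≡ (c + a) + b
      rotate = solve-∀

  -- The empty word: only C(i, 0) = 1 at j = 0 survives, and g 0 0 = 1.
  h-empty : ∀ j → h 0 j ≡ δ 0 j
  h-empty zero    = trans (+-identityʳ _) (trans (+-identityʳ _) (empty rec 0))
  h-empty (suc J) = Σ-zero (suc (suc J)) (λ i i≤ → cong (_* g (suc J) i) (k>n⇒nCk≡0 (short i (≤-pred i≤))))
    where
    short : ∀ i → i ≤ suc J → i < 2 * suc J
    short i i≤ = subst (i <_) (sym (double-suc J)) (s≤s (≤-trans i≤ (s≤s (m≤m+n J (J + 0)))))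

  -- Pascal's rule on C(m+1+i, 2J+2) splits h (m+1) (J+1) into h m (J+1) and the key sum.
  h-first-entry : ∀ m j → h (suc m) j ≡ h m j + branch g h m j
  h-first-entry m zero    = sym (trans (cong (h m 0 +_) (branch-zero g h m)) (+-identityʳ _))
  h-first-entry m (suc J) = begin
    Σ< (suc (suc J)) (λ i → ((suc m + i) C (2 * suc J)) * g (suc J) i)
      ≡⟨ Σ-ext (suc (suc J)) pascal ⟩
    Σ< (suc (suc J)) (λ i → ((m + i) C suc (2 * J)) * g (suc J) i + ((m + i) C (2 * suc J)) * g (suc J) i)
      ≡⟨ Σ-+ (suc (suc J)) (λ i → ((m + i) C suc (2 * J)) * g (suc J) i) (λ i → ((m + i) C (2 * suc J)) * g (suc J) i) ⟩
    KeyIdentity.lhs m J + h m (suc J)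
      ≡⟨ +-comm (KeyIdentity.lhs m J) _ ⟩
    h m (suc J) + KeyIdentity.lhs m J
      ≡⟨ cong (h m (suc J) +_) (KeyIdentity.key m J) ⟩
    h m (suc J) + branch g h m (suc J) ∎
    where
    pascal : ∀ i → ((suc m + i) C (2 * suc J)) * g (suc J) i
                   ≡ ((m + i) C suc (2 * J)) * g (suc J) i + ((m + i) C (2 * suc J)) * g (suc J) i
    pascal i = begin
      ((suc m + i) C (2 * suc J)) * g (suc J) i
        ≡⟨ cong (λ t → ((suc m + i) C t) * g (suc J) i) (double-suc J) ⟩
      ((suc m + i) C suc (suc (2 * J))) * g (suc J) i
        ≡⟨ cong (_* g (suc J) i) (sym (nCk+nC[k+1]≡[n+1]C[k+1] (m + i) (suc (2 * J)))) ⟩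
      ((m + i) C suc (2 * J) + (m + i) C suc (suc (2 * J))) * g (suc J) i
        ≡⟨ *-distribʳ-+ (g (suc J) i) ((m + i) C suc (2 * J)) _ ⟩
      ((m + i) C suc (2 * J)) * g (suc J) i + ((m + i) C suc (suc (2 * J))) * g (suc J) i
        ≡⟨ cong (λ t → ((m + i) C suc (2 * J)) * g (suc J) i + ((m + i) C t) * g (suc J) i) (sym (double-suc J)) ⟩
      ((m + i) C suc (2 * J)) * g (suc J) i + ((m + i) C (2 * suc J)) * g (suc J) i ∎

  recursion : FirstEntryRecursion g h
  recursion = record { empty = h-empty ; first-entry = h-first-entry }

tower-recursion : ∀ e → FirstEntryRecursion (tower e) (tower (suc e))
tower-recursion zero = record
  { empty       = tower-1 0
  ; first-entry = λ m j → begin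
      tower 1 (suc m) j                   ≡⟨ trans (tower-1 (suc m) j) (sym (tower-1 m j)) ⟩
      tower 1 m j                         ≡⟨ sym (+-identityʳ _) ⟩
      tower 1 m j + 0                     ≡⟨ cong (tower 1 m j +_) (sym (Σ-zero m (λ u _ → glue-zero (δ (suc u)) _ j (λ _ → refl)))) ⟩
      tower 1 m j + branch δ (tower 1) m j ∎
  }
tower-recursion (suc e) =
  TransformStep.recursion (tower e) (tower-recursion e) (tower-triangular e) (tower-00 e)

chainSum : ℕ → ℕ → ℕ → (List ℕ → ℕ) → ℕ
chainSum l lo hi F = ΣL F (chains l lo hi)

chainSum-first : ∀ l lo hi F →
  chainSum (suc l) lo hi F ≡ Σ< (suc hi ∸ lo) (λ t → chainSum l (lo + t) hi (λ c → F ((lo + t) ∷ c)))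
chainSum-first l lo hi F = trans (ΣL-concatMap F (λ v → map (v ∷_) (chains l v hi)) (range lo hi))
  (trans (ΣL-applyUpTo (λ v → ΣL F (map (v ∷_) (chains l v hi))) (lo +_) (suc hi ∸ lo))
    (Σ-ext (suc hi ∸ lo) (λ t → ΣL-map F ((lo + t) ∷_) (chains l (lo + t) hi))))

chainSum-last : ∀ l lo hi F →
  chainSum (suc l) lo hi F ≡ Σ< (suc hi ∸ lo) (λ t → chainSum l lo (lo + t) (λ c → F (c ++ (lo + t) ∷ [])))
chainSum-last zero    lo hi F = chainSum-first 0 lo hi F
chainSum-last (suc l) lo hi F = begin
  chainSum (suc (suc l)) lo hi F
    ≡⟨ chainSum-first (suc l) lo hi F ⟩
  Σ< D (λ s → chainSum (suc l) (lo + s) hi (λ c → F ((lo + s) ∷ c)))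
    ≡⟨ Σ-ext D (λ s → chainSum-last l (lo + s) hi (λ c → F ((lo + s) ∷ c))) ⟩
  Σ< D (λ s → Σ< (suc hi ∸ (lo + s)) (λ t → ψ′ s ((lo + s) + t)))
    ≡⟨ Σ-ext D (λ s → trans (cong (λ z → Σ< z (λ t → ψ′ s ((lo + s) + t))) (sym (∸-+-assoc (suc hi) lo s)))
                              (Σ-ext (D ∸ s) (λ t → cong (ψ′ s) (+-assoc lo s t)))) ⟩
  Σ< D (λ s → Σ< (D ∸ s) (λ t → ψ s (s + t)))
    ≡⟨ sym (Σ-triangle D ψ) ⟩
  Σ< D (λ t → Σ< (suc t) (λ s → ψ s t))
    ≡⟨ Σ-ext D (λ t → trans (cong (λ z → Σ< z (λ s → ψ s t)) (trans (sym (m+n∸m≡n lo (suc t))) (cong (_∸ lo) (+-suc lo t))))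
                             (sym (chainSum-first l lo (lo + t) (λ c → F (c ++ (lo + t) ∷ []))))) ⟩
  Σ< D (λ t → chainSum (suc l) lo (lo + t) (λ c → F (c ++ (lo + t) ∷ []))) ∎
  where
  D = suc hi ∸ lo
  ψ′ : ℕ → ℕ → ℕ
  ψ′ s top = chainSum l (lo + s) top (λ c → F ((lo + s) ∷ c ++ top ∷ []))
  ψ : ℕ → ℕ → ℕ
  ψ s t = ψ′ s (lo + t)

headFactor : ℕ → List ℕ → ℕ
headFactor y (p ∷ q ∷ r) = (q + y) C (2 * p)
headFactor y _           = 1

tripleProd-∷ : ∀ y L → tripleProd (y ∷ L) ≡ headFactor y L * tripleProd L
tripleProd-∷ y []          = refl
tripleProd-∷ y (p ∷ [])    = refl
tripleProd-∷ y (p ∷ q ∷ r) = refl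

headFactor-snoc : ∀ y ys a b c → headFactor y (ys ++ a ∷ b ∷ c ∷ []) ≡ headFactor y (ys ++ a ∷ b ∷ [])
headFactor-snoc y []           a b c = refl
headFactor-snoc y (x ∷ [])     a b c = refl
headFactor-snoc y (x ∷ x′ ∷ ys) a b c = refl

tripleProd-snoc : ∀ ys a b c → tripleProd (ys ++ a ∷ b ∷ c ∷ []) ≡ tripleProd (ys ++ a ∷ b ∷ []) * ((c + a) C (2 * b))
tripleProd-snoc []       a b c = trans (*-identityʳ _) (sym (*-identityˡ _))
tripleProd-snoc (y ∷ ys) a b c = begin
  tripleProd (y ∷ ys ++ a ∷ b ∷ c ∷ [])
    ≡⟨ tripleProd-∷ y (ys ++ a ∷ b ∷ c ∷ []) ⟩
  headFactor y (ys ++ a ∷ b ∷ c ∷ []) * tripleProd (ys ++ a ∷ b ∷ c ∷ [])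
    ≡⟨ cong₂ _*_ (headFactor-snoc y ys a b c) (tripleProd-snoc ys a b c) ⟩
  headFactor y (ys ++ a ∷ b ∷ []) * (tripleProd (ys ++ a ∷ b ∷ []) * ((c + a) C (2 * b)))
    ≡⟨ sym (*-assoc (headFactor y (ys ++ a ∷ b ∷ [])) _ _) ⟩
  headFactor y (ys ++ a ∷ b ∷ []) * tripleProd (ys ++ a ∷ b ∷ []) * ((c + a) C (2 * b))
    ≡⟨ cong (_* ((c + a) C (2 * b))) (sym (tripleProd-∷ y (ys ++ a ∷ b ∷ []))) ⟩
  tripleProd (y ∷ ys ++ a ∷ b ∷ []) * ((c + a) C (2 * b)) ∎

-- Summing out the last free chain entry i_{k-1} = t turns rhs (k+1) into the transform of rhs k.
rhs-transform : ∀ k n j → rhs (suc (suc k)) n j ≡ transform (rhs (suc k)) n j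
rhs-transform k n j = begin
  chainSum (suc k) 0 j (λ c → tripleProd (0 ∷ c ++ j ∷ n ∷ []))
    ≡⟨ chainSum-last k 0 j (λ c → tripleProd (0 ∷ c ++ j ∷ n ∷ [])) ⟩
  Σ< (suc j) (λ t → chainSum k 0 t (λ c → tripleProd (0 ∷ (c ++ t ∷ []) ++ j ∷ n ∷ [])))
    ≡⟨ Σ-ext (suc j) (λ t → ΣL-ext (chains k 0 t) (λ c →
          trans (cong (λ z → tripleProd (0 ∷ z)) (++-assoc c (t ∷ []) (j ∷ n ∷ [])))
                (tripleProd-snoc (0 ∷ c) t j n))) ⟩
  Σ< (suc j) (λ t → chainSum k 0 t (λ c → tripleProd (0 ∷ c ++ t ∷ j ∷ []) * ((n + t) C (2 * j))))
    ≡⟨ Σ-ext (suc j) (λ t → trans (ΣL-*ʳ (λ c → tripleProd (0 ∷ c ++ t ∷ j ∷ [])) ((n + t) C (2 * j)) (chains k 0 t))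
          (*-comm (chainSum k 0 t (λ c → tripleProd (0 ∷ c ++ t ∷ j ∷ []))) ((n + t) C (2 * j)))) ⟩
  transform (rhs (suc k)) n j ∎

rhs≡tower : ∀ k n j → rhs (suc k) n j ≡ tower (suc (suc k)) n j
rhs≡tower zero    n j = begin
  ((n + 0) C (2 * j)) * 1 + 0
    ≡⟨ cong (_+ 0) (*-identityʳ _) ⟩
  ((n + 0) C (2 * j)) + 0
    ≡⟨ cong (((n + 0) C (2 * j)) +_) (sym (Σ-zero j (λ i _ →
          trans (cong (((n + suc i) C (2 * j)) *_) (tower-1 j (suc i))) (*-zeroʳ ((n + suc i) C (2 * j)))))) ⟩
  ((n + 0) C (2 * j)) + Σ< j (λ i → ((n + suc i) C (2 * j)) * tower 1 j (suc i))
    ≡⟨ cong (_+ Σ< j (λ i → ((n + suc i) C (2 * j)) * tower 1 j (suc i))) (sym (*-identityʳ _)) ⟩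
  tower 2 n j ∎
rhs≡tower (suc k) n j = trans (rhs-transform k n j)
  (Σ-ext (suc j) (λ i → cong (((n + i) C (2 * j)) *_) (rhs≡tower k j i)))

-- 0-based lookup σ₍ᵢ₊₁₎ and the index list [a, a + n).
lk : List ℕ → ℕ → ℕ
lk σ i = at σ (suc i)

rng : ℕ → ℕ → List ℕ
rng a n = applyUpTo (a +_) n

module _ {A : Set} where

  any-ext : ∀ {P Q : A → Bool} L → (∀ x → P x ≡ Q x) → any P L ≡ any Q L
  any-ext []      eq = refl
  any-ext (x ∷ L) eq = cong₂ _∨_ (eq x) (any-ext L eq)

  all-ext : ∀ {P Q : A → Bool} L → (∀ x → P x ≡ Q x) → all P L ≡ all Q L
  all-ext []      eq = refl
  all-ext (x ∷ L) eq = cong₂ _∧_ (eq x) (all-ext L eq)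

  any-∧ʳ : ∀ (P : A → Bool) c L → any (λ x → P x ∧ c) L ≡ any P L ∧ c
  any-∧ʳ P c []      = refl
  any-∧ʳ P c (x ∷ L) = trans (cong (P x ∧ c ∨_) (any-∧ʳ P c L)) (distrib (P x) (any P L) c)
    where
    distrib : ∀ a b c → (a ∧ c) ∨ (b ∧ c) ≡ (a ∨ b) ∧ c
    distrib true  b true  = refl
    distrib true  b false = ∧-zeroʳ b
    distrib false b c     = refl

any-map : ∀ (P : ℕ → Bool) (f : ℕ → ℕ) L → any P (map f L) ≡ any (λ x → P (f x)) L
any-map P f []      = refl
any-map P f (x ∷ L) = cong (P (f x) ∨_) (any-map P f L)

any-rng-suc : ∀ {P : ℕ → Bool} a n → any P (rng (suc a) n) ≡ any (λ i → P (suc i)) (rng a n)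
any-rng-suc {P} a n = trans (cong (any P) (sym (map-applyUpTo (a +_) suc n))) (any-map P suc (rng a n))

all-rng-suc : ∀ {P : ℕ → Bool} a n → all P (rng (suc a) n) ≡ all (λ i → P (suc i)) (rng a n)
all-rng-suc {P} a n = trans (cong (all P) (sym (map-applyUpTo (a +_) suc n))) (lemma (rng a n))
  where
  lemma : ∀ L → all P (map suc L) ≡ all (λ i → P (suc i)) L
  lemma []      = refl
  lemma (x ∷ L) = cong (P (suc x) ∧_) (lemma L)

ΣL-rng-suc : ∀ (F : ℕ → ℕ) a n → ΣL F (rng (suc a) n) ≡ ΣL (λ i → F (suc i)) (rng a n)
ΣL-rng-suc F a n = trans (cong (ΣL F) (sym (map-applyUpTo (a +_) suc n))) (ΣL-map F suc (rng a n))

-- Structural versions of the statistics of Defs, by recursion on the word.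
-- occurs231After v ys: some entries b before c in ys have c < v < b (a 231 with v as the "2").
occurs231After : ℕ → List ℕ → Bool
occurs231After v []       = false
occurs231After v (y ∷ ys) = (any (λ c → c <ᵇ v) ys ∧ (v <ᵇ y)) ∨ occurs231After v ys

has231 : List ℕ → Bool
has231 []       = false
has231 (x ∷ xs) = occurs231After x xs ∨ has231 xs

descents : List ℕ → ℕ
descents []          = 0
descents (x ∷ [])    = 0
descents (x ∷ y ∷ r) = ι (y <ᵇ x) + descents (y ∷ r)

-- Every entry satisfies i - σᵢ ≤ k, where the word occupies positions p+1, p+2, ….
bounded : ℕ → ℕ → List ℕ → Bool
bounded p k []       = true
bounded p k (x ∷ xs) = ((suc p ∸ x) ≤ᵇ k) ∧ bounded (suc p) k xs

-- contains231 agrees with has231.  The index-based form is first stated for a function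
-- g : ℕ → ℕ (0-based), peeled at index 0, and finally specialised to g = lk σ.
Has231 : (ℕ → ℕ) → ℕ → Bool
Has231 g n = any (λ a → any (λ b → any (λ c → (g c <ᵇ g a) ∧ (g a <ᵇ g b))
                   (rng (suc b) (n ∸ suc b))) (rng (suc a) (n ∸ suc a))) (rng 0 n)

Occurs231After : ℕ → (ℕ → ℕ) → ℕ → Bool
Occurs231After v g m = any (λ b → any (λ c → (g c <ᵇ v) ∧ (v <ᵇ g b)) (rng (suc b) (m ∸ suc b))) (rng 0 m)

contains231≡Has231 : ∀ n σ → contains231 n σ ≡ Has231 (lk σ) n
contains231≡Has231 n σ =
  trans (any-rng-suc {outer} 0 n) (any-ext (rng 0 n) (λ a → trans (any-rng-suc {middle a} (suc a) (n ∸ suc a))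
    (any-ext (rng (suc a) (n ∸ suc a)) (λ b → any-rng-suc {inner a b} (suc b) (n ∸ suc b)))))
  where
  inner : ℕ → ℕ → ℕ → Bool
  inner a b c = (at σ c <ᵇ lk σ a) ∧ (lk σ a <ᵇ lk σ b)
  middle : ℕ → ℕ → Bool
  middle a b = any (λ c → (at σ c <ᵇ lk σ a) ∧ (lk σ a <ᵇ at σ b)) (range (suc b) n)
  outer : ℕ → Bool
  outer a = any (λ b → any (λ c → (at σ c <ᵇ at σ a) ∧ (at σ a <ᵇ at σ b)) (range (suc b) n)) (range (suc a) n)

-- Peeling off index 0: either it plays the role of the "2", or the 231 lies further right.
Has231-suc : ∀ g m → Has231 g (suc m) ≡ Occurs231After (g 0) (λ i → g (suc i)) m ∨ Has231 (λ i → g (suc i)) m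
Has231-suc g m = cong₂ _∨_
  (trans (any-rng-suc {first 0} 0 m) (any-ext (rng 0 m) (λ b → any-rng-suc {is231 0 (suc b)} (suc b) (m ∸ suc b))))
  (trans (any-rng-suc {later} 0 m) (any-ext (rng 0 m) (λ a → trans (any-rng-suc {first (suc a)} (suc a) (m ∸ suc a))
    (any-ext (rng (suc a) (m ∸ suc a)) (λ b → any-rng-suc {is231 (suc a) (suc b)} (suc b) (m ∸ suc b))))))
  where
  is231 : ℕ → ℕ → ℕ → Bool
  is231 a b c = (g c <ᵇ g a) ∧ (g a <ᵇ g b)
  first : ℕ → ℕ → Bool
  first a b = any (is231 a b) (rng (suc b) (suc m ∸ suc b))
  later : ℕ → Bool
  later a = any (first a) (rng (suc a) (suc m ∸ suc a))

-- Peeling off index 0 in Occurs231After: either g 0 is the "3", or the pattern lies further right.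
Occurs231After-suc : ∀ v g m → Occurs231After v g (suc m)
  ≡ (any (λ c → g (suc c) <ᵇ v) (rng 0 m) ∧ (v <ᵇ g 0)) ∨ Occurs231After v (λ i → g (suc i)) m
Occurs231After-suc v g m = cong₂ _∨_
  (trans (any-rng-suc {is231 0} 0 m) (any-∧ʳ (λ c → g (suc c) <ᵇ v) (v <ᵇ g 0) (rng 0 m)))
  (trans (any-rng-suc {later} 0 m) (any-ext (rng 0 m) (λ b → any-rng-suc {is231 (suc b)} (suc b) (m ∸ suc b))))
  where
  is231 : ℕ → ℕ → Bool
  is231 b c = (g c <ᵇ v) ∧ (v <ᵇ g b)
  later : ℕ → Bool
  later b = any (is231 b) (rng (suc b) (suc m ∸ suc b))

any-lk : ∀ (P : ℕ → Bool) ys → any (λ c → P (lk ys c)) (rng 0 (length ys)) ≡ any P ys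
any-lk P []       = refl
any-lk P (y ∷ ys) = cong (P y ∨_) (trans (any-rng-suc 0 (length ys)) (any-lk P ys))

Occurs231After-lk : ∀ v ys → Occurs231After v (lk ys) (length ys) ≡ occurs231After v ys
Occurs231After-lk v []       = refl
Occurs231After-lk v (y ∷ ys) = trans (Occurs231After-suc v (lk (y ∷ ys)) (length ys))
  (cong₂ _∨_ (cong (_∧ (v <ᵇ y)) (any-lk (λ c → c <ᵇ v) ys)) (Occurs231After-lk v ys))

Has231-lk : ∀ σ → Has231 (lk σ) (length σ) ≡ has231 σ
Has231-lk []       = refl
Has231-lk (x ∷ xs) = trans (Has231-suc (lk (x ∷ xs)) (length xs))
  (cong₂ _∨_ (Occurs231After-lk x xs) (Has231-lk xs))

contains231≡has231 : ∀ σ → contains231 (length σ) σ ≡ has231 σ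
contains231≡has231 σ = trans (contains231≡Has231 (length σ) σ) (Has231-lk σ)

length-filter : ∀ {A : Set} (P : A → Bool) L → length (filterᵇ P L) ≡ ΣL (λ x → ι (P x)) L
length-filter P []      = refl
length-filter P (x ∷ L) with P x
... | true  = cong suc (length-filter P L)
... | false = length-filter P L

Descents : (ℕ → ℕ) → ℕ → ℕ
Descents g n = ΣL (λ i → ι (g (suc i) <ᵇ g i)) (rng 0 n)

des≡Descents : ∀ n σ → des n σ ≡ Descents (lk σ) (n ∸ 1)
des≡Descents n σ = trans (length-filter (λ i → at σ (suc i) <ᵇ at σ i) (rng 1 (n ∸ 1)))
  (ΣL-rng-suc (λ i → ι (at σ (suc i) <ᵇ at σ i)) 0 (n ∸ 1))

descents≡Descents : ∀ σ → descents σ ≡ Descents (lk σ) (length σ ∸ 1)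
descents≡Descents []          = refl
descents≡Descents (x ∷ [])    = refl
descents≡Descents (x ∷ y ∷ r) = cong (ι (y <ᵇ x) +_)
  (trans (descents≡Descents (y ∷ r)) (sym (ΣL-rng-suc (λ i → ι (lk (x ∷ y ∷ r) (suc i) <ᵇ lk (x ∷ y ∷ r) i)) 0 (length r))))

des≡descents : ∀ σ → des (length σ) σ ≡ descents σ
des≡descents σ = trans (des≡Descents (length σ) σ) (sym (descents≡Descents σ))

Bounded : ℕ → ℕ → (ℕ → ℕ) → ℕ → Bool
Bounded p k g n = all (λ i → (suc (p + i) ∸ g i) ≤ᵇ k) (rng 0 n)

bounded≡Bounded : ∀ p k σ → bounded p k σ ≡ Bounded p k (lk σ) (length σ)
bounded≡Bounded p k []       = refl
bounded≡Bounded p k (x ∷ xs) = sym (cong₂ _∧_ (cong (λ t → (suc t ∸ x) ≤ᵇ k) (+-identityʳ p))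
  (trans (all-rng-suc 0 (length xs))
    (trans (all-ext (rng 0 (length xs)) (λ i → cong (λ t → (suc t ∸ lk xs i) ≤ᵇ k) (+-suc p i)))
      (sym (bounded≡Bounded (suc p) k xs)))))

boundedBy≡bounded : ∀ k σ → boundedBy (length σ) k σ ≡ bounded 0 k σ
boundedBy≡bounded k σ = trans (all-rng-suc 0 (length σ)) (sym (bounded≡Bounded 0 k σ))

<ᵇ-true : ∀ m n → (m <ᵇ n) ≡ true → m < n
<ᵇ-true m n eq = <ᵇ⇒< m n (subst T (sym eq) tt)

<ᵇ-false : ∀ m n → (m <ᵇ n) ≡ false → n ≤ m
<ᵇ-false m n eq = ≮⇒≥ (λ m<n → subst T eq (<⇒<ᵇ m<n))

<⇒<ᵇ-true : ∀ {m n} → m < n → (m <ᵇ n) ≡ true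
<⇒<ᵇ-true {m} {n} m<n with m <ᵇ n in eq
... | true  = refl
... | false = ⊥-elim (subst T eq (<⇒<ᵇ m<n))

≥⇒<ᵇ-false : ∀ {m n} → n ≤ m → (m <ᵇ n) ≡ false
≥⇒<ᵇ-false {m} {n} n≤m with m <ᵇ n in eq
... | false = refl
... | true  = ⊥-elim (<⇒≱ (<ᵇ-true m n eq) n≤m)

≡ᵇ-true : ∀ m n → (m ≡ᵇ n) ≡ true → m ≡ n
≡ᵇ-true m n eq = ≡ᵇ⇒≡ m n (subst T (sym eq) tt)

≢⇒≡ᵇ-false : ∀ {m n} → m ≢ n → (m ≡ᵇ n) ≡ false
≢⇒≡ᵇ-false {m} {n} m≢n with m ≡ᵇ n in eq
... | false = refl
... | true  = ⊥-elim (m≢n (≡ᵇ-true m n eq))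

≡ᵇ-refl : ∀ m → (m ≡ᵇ m) ≡ true
≡ᵇ-refl zero    = refl
≡ᵇ-refl (suc m) = ≡ᵇ-refl m

∧-true₁ : ∀ {a b} → a ∧ b ≡ true → a ≡ true
∧-true₁ {true} _ = refl

∧-true₂ : ∀ {a b} → a ∧ b ≡ true → b ≡ true
∧-true₂ {true} eq = eq

∨-false₁ : ∀ {a b} → a ∨ b ≡ false → a ≡ false
∨-false₁ {false} _ = refl

∨-false₂ : ∀ {a b} → a ∨ b ≡ false → b ≡ false
∨-false₂ {false} eq = eq

not-true : ∀ {a} → not a ≡ true → a ≡ false
not-true {false} _ = refl

true≢false : true ≢ false
true≢false ()

refute : ∀ {b} → (b ≡ true → ⊥) → b ≡ false
refute {false} _  = refl
refute {true}  ¬b = ⊥-elim (¬b refl)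

module _ {A : Set} where

  any-++ : ∀ (P : A → Bool) x y → any P (x ++ y) ≡ any P x ∨ any P y
  any-++ P []      y = refl
  any-++ P (a ∷ x) y = trans (cong (P a ∨_) (any-++ P x y)) (sym (∨-assoc (P a) _ _))

  all-mono : ∀ (P Q : A → Bool) x → (∀ e → P e ≡ true → Q e ≡ true) → all P x ≡ true → all Q x ≡ true
  all-mono P Q []      imp eq = refl
  all-mono P Q (a ∷ x) imp eq = cong₂ _∧_ (imp a (∧-true₁ eq)) (all-mono P Q x imp (∧-true₂ {P a} eq))

  all⇒¬any : ∀ (P Q : A → Bool) x → (∀ e → Q e ≡ true → P e ≡ false) → all Q x ≡ true → any P x ≡ false
  all⇒¬any P Q []      imp eq = refl
  all⇒¬any P Q (a ∷ x) imp eq = cong₂ _∨_ (imp a (∧-true₁ eq)) (all⇒¬any P Q x imp (∧-true₂ {Q a} eq))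

allBelow : ℕ → List ℕ → Bool
allBelow v x = all (λ e → e <ᵇ v) x

allAbove : ℕ → List ℕ → Bool
allAbove v y = all (λ e → v <ᵇ e) y

allAbove-mono : ∀ a v y → a < v → allAbove v y ≡ true → allAbove a y ≡ true
allAbove-mono a v y a<v = all-mono (v <ᵇ_) (a <ᵇ_) y (λ e v<e → <⇒<ᵇ-true (<-trans a<v (<ᵇ-true v e v<e)))

noneBelow : ∀ a y → allAbove a y ≡ true → any (λ c → c <ᵇ a) y ≡ false
noneBelow a y = all⇒¬any (_<ᵇ a) (a <ᵇ_) y (λ e a<e → ≥⇒<ᵇ-false (<⇒≤ (<ᵇ-true a e a<e)))

notInAbove : ∀ a y → allAbove a y ≡ true → any (λ z → a ≡ᵇ z) y ≡ false
notInAbove a y = all⇒¬any (a ≡ᵇ_) (a <ᵇ_) y (λ e a<e → ≢⇒≡ᵇ-false (<⇒≢ (<ᵇ-true a e a<e)))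

notInBelow : ∀ v x → allBelow v x ≡ true → any (λ z → v ≡ᵇ z) x ≡ false
notInBelow v x = all⇒¬any (v ≡ᵇ_) (_<ᵇ v) x (λ e e<v → ≢⇒≡ᵇ-false (λ v≡e → <-irrefl (sym v≡e) (<ᵇ-true e v e<v)))

occurs231After-above : ∀ a y → allAbove a y ≡ true → occurs231After a y ≡ false
occurs231After-above a []      _   = refl
occurs231After-above a (b ∷ y) abv =
  trans (cong (λ t → (t ∧ (a <ᵇ b)) ∨ occurs231After a y) (noneBelow a y (∧-true₂ abv)))
        (occurs231After-above a y (∧-true₂ abv))

occurs231After-++-above : ∀ a x y → allAbove a y ≡ true → occurs231After a (x ++ y) ≡ occurs231After a x
occurs231After-++-above a []      y abv = occurs231After-above a y abv
occurs231After-++-above a (b ∷ x) y abv = cong₂ _∨_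
  (cong (_∧ (a <ᵇ b)) (trans (any-++ (λ c → c <ᵇ a) x y)
    (trans (cong (any (λ c → c <ᵇ a) x ∨_) (noneBelow a y abv)) (∨-identityʳ _))))
  (occurs231After-++-above a x y abv)

occurs231After-below-++ : ∀ v x y → allBelow v x ≡ true → occurs231After v (x ++ y) ≡ occurs231After v y
occurs231After-below-++ v []      y blw = refl
occurs231After-below-++ v (b ∷ x) y blw =
  trans (cong (λ t → (any (λ c → c <ᵇ v) (x ++ y) ∧ t) ∨ occurs231After v (x ++ y))
              (≥⇒<ᵇ-false (<⇒≤ (<ᵇ-true b v (∧-true₁ blw)))))
  (trans (cong (_∨ occurs231After v (x ++ y)) (∧-zeroʳ _)) (occurs231After-below-++ v x y (∧-true₂ blw)))

has231-++ : ∀ v x y → allBelow v x ≡ true → allAbove v y ≡ true → has231 (x ++ y) ≡ has231 x ∨ has231 y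
has231-++ v []      y blw abv = refl
has231-++ v (a ∷ x) y blw abv = trans
  (cong₂ _∨_ (occurs231After-++-above a x y (allAbove-mono a v y (<ᵇ-true a v (∧-true₁ blw)) abv))
             (has231-++ v x y (∧-true₂ blw) abv))
  (sym (∨-assoc (occurs231After a x) (has231 x) (has231 y)))

distinct-++ : ∀ v x y → allBelow v x ≡ true → allAbove v y ≡ true → distinct (x ++ y) ≡ distinct x ∧ distinct y
distinct-++ v []      y blw abv = refl
distinct-++ v (a ∷ x) y blw abv = trans
  (cong₂ (λ s t → not s ∧ t)
    (trans (any-++ (λ z → a ≡ᵇ z) x y)
      (trans (cong (any (λ z → a ≡ᵇ z) x ∨_) (notInAbove a y (allAbove-mono a v y (<ᵇ-true a v (∧-true₁ blw)) abv)))
             (∨-identityʳ _)))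
    (distinct-++ v x y (∧-true₂ blw) abv))
  (sym (∧-assoc (not (any (λ z → a ≡ᵇ z) x)) (distinct x) (distinct y)))

bounded-++ : ∀ q k x y → bounded q k (x ++ y) ≡ bounded q k x ∧ bounded (q + length x) k y
bounded-++ q k []      y = cong (λ t → bounded t k y) (sym (+-identityʳ q))
bounded-++ q k (a ∷ x) y = trans
  (cong (((suc q ∸ a) ≤ᵇ k) ∧_)
    (trans (bounded-++ (suc q) k x y) (cong (λ t → bounded (suc q) k x ∧ bounded t k y) (sym (+-suc q (length x))))))
  (sym (∧-assoc ((suc q ∸ a) ≤ᵇ k) (bounded (suc q) k x) _))

descents-++ : ∀ v x y → allBelow v x ≡ true → allAbove v y ≡ true → descents (x ++ y) ≡ descents x + descents y
descents-++ v []           y       blw abv = refl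
descents-++ v (a ∷ [])     []      blw abv = refl
descents-++ v (a ∷ [])     (b ∷ y) blw abv =
  cong (λ t → ι t + descents (b ∷ y)) (≥⇒<ᵇ-false (<⇒≤ (<-trans (<ᵇ-true a v (∧-true₁ blw)) (<ᵇ-true v b (∧-true₁ abv)))))
descents-++ v (a ∷ a′ ∷ x) y       blw abv =
  trans (cong (ι (a′ <ᵇ a) +_) (descents-++ v (a′ ∷ x) y (∧-true₂ {a <ᵇ v} blw) abv))
        (sym (+-assoc (ι (a′ <ᵇ a)) _ _))

-- Translating all values by s changes none of the statistics (the bound being taken
-- relative to a shifted offset); this rests on comparisons being invariant under adding s
-- to both sides.
+-≡ᵇ : ∀ s a e → (s + a ≡ᵇ s + e) ≡ (a ≡ᵇ e)
+-≡ᵇ zero    a e = refl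
+-≡ᵇ (suc s) a e = +-≡ᵇ s a e

+-<ᵇ : ∀ s a e → (s + a <ᵇ s + e) ≡ (a <ᵇ e)
+-<ᵇ zero    a e = refl
+-<ᵇ (suc s) a e = +-<ᵇ s a e

distinct-shift : ∀ s z → distinct (map (s +_) z) ≡ distinct z
distinct-shift s []      = refl
distinct-shift s (a ∷ z) = cong₂ (λ p q → not p ∧ q)
  (trans (any-map (λ e → (s + a) ≡ᵇ e) (s +_) z) (any-ext z (+-≡ᵇ s a))) (distinct-shift s z)

occurs231After-shift : ∀ s a z → occurs231After (s + a) (map (s +_) z) ≡ occurs231After a z
occurs231After-shift s a []      = refl
occurs231After-shift s a (b ∷ z) = cong₂ _∨_
  (cong₂ _∧_ (trans (any-map (λ c → c <ᵇ (s + a)) (s +_) z) (any-ext z (λ c → +-<ᵇ s c a))) (+-<ᵇ s a b))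
  (occurs231After-shift s a z)

has231-shift : ∀ s z → has231 (map (s +_) z) ≡ has231 z
has231-shift s []      = refl
has231-shift s (a ∷ z) = cong₂ _∨_ (occurs231After-shift s a z) (has231-shift s z)

descents-shift : ∀ s z → descents (map (s +_) z) ≡ descents z
descents-shift s []          = refl
descents-shift s (a ∷ [])    = refl
descents-shift s (a ∷ b ∷ z) = cong₂ _+_ (cong ι (+-<ᵇ s b a)) (descents-shift s (b ∷ z))

bounded-shift : ∀ s q k z → bounded (q + s) k (map (s +_) z) ≡ bounded q k z
bounded-shift s q k []      = refl
bounded-shift s q k (a ∷ z) = cong₂ _∧_
  (cong (_≤ᵇ k) (trans (cong (_∸ (s + a)) (+-comm (suc q) s)) ([m+n]∸[m+o]≡n∸o s (suc q) a)))
  (bounded-shift s (suc q) k z)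

allAbove-shift : ∀ s z → All (1 ≤_) z → allAbove s (map (s +_) z) ≡ true
allAbove-shift s []      _          = refl
allAbove-shift s (a ∷ z) (1≤a ∷ ps) =
  cong₂ _∧_ (<⇒<ᵇ-true (subst (_< s + a) (+-identityʳ s) (+-monoʳ-< s 1≤a))) (allAbove-shift s z ps)

module _ {A : Set} where

  all⇒All : ∀ (P : A → Bool) x → all P x ≡ true → All (λ e → P e ≡ true) x
  all⇒All P []      eq = []
  all⇒All P (a ∷ x) eq = ∧-true₁ eq ∷ all⇒All P x (∧-true₂ {P a} eq)

  ¬any⇒All : ∀ (P : A → Bool) x → any P x ≡ false → All (λ e → P e ≡ false) x
  ¬any⇒All P []      eq = []
  ¬any⇒All P (a ∷ x) eq = ∨-false₁ eq ∷ ¬any⇒All P x (∨-false₂ {P a} eq)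

  ¬all⇒witness : ∀ (P : A → Bool) x → all P x ≡ false → ∃ λ a → a ∈ x × P a ≡ false
  ¬all⇒witness P (a ∷ x) eq with P a in pa
  ... | false = a , here refl , pa
  ... | true with ¬all⇒witness P x eq
  ...   | b , b∈x , pb = b , there b∈x , pb

∉-entries : ∀ v w a → any (v ≡ᵇ_) w ≡ false → a ∈ w → v ≢ a
∉-entries v w a eq a∈w refl = true≢false (trans (sym (≡ᵇ-refl v)) (All.lookup (¬any⇒All (v ≡ᵇ_) w eq) a∈w))

head-fresh : ∀ a w → distinct (a ∷ w) ≡ true → any (a ≡ᵇ_) w ≡ false
head-fresh a w d = not-true (∧-true₁ d)

tail-distinct : ∀ a w → distinct (a ∷ w) ≡ true → distinct w ≡ true
tail-distinct a w d = ∧-true₂ {not (any (a ≡ᵇ_) w)} d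

distinct-prefix : ∀ x y → distinct (x ++ y) ≡ true → distinct x ≡ true
distinct-prefix []      y d = refl
distinct-prefix (a ∷ x) y d = cong₂ _∧_
  (cong not (∨-false₁ (trans (sym (any-++ (a ≡ᵇ_) x y)) (head-fresh a (x ++ y) d))))
  (distinct-prefix x y (tail-distinct a (x ++ y) d))

distinct-suffix : ∀ x y → distinct (x ++ y) ≡ true → distinct y ≡ true
distinct-suffix []      y d = d
distinct-suffix (a ∷ x) y d = distinct-suffix x y (tail-distinct a (x ++ y) d)

distinct-left∉right : ∀ x y a → distinct (x ++ y) ≡ true → a ∈ x → any (a ≡ᵇ_) y ≡ false
distinct-left∉right (a ∷ x) y .a d (here refl) =
  ∨-false₂ {any (a ≡ᵇ_) x} (trans (sym (any-++ (a ≡ᵇ_) x y)) (head-fresh a (x ++ y) d))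
distinct-left∉right (c ∷ x) y a d (there a∈x) = distinct-left∉right x y a (tail-distinct c (x ++ y) d) a∈x

distinct-right∉left : ∀ x y b → distinct (x ++ y) ≡ true → b ∈ y → any (b ≡ᵇ_) x ≡ false
distinct-right∉left []      y b d b∈y = refl
distinct-right∉left (c ∷ x) y b d b∈y = cong₂ _∨_
  (≢⇒≡ᵇ-false (λ b≡c → ∉-entries c (x ++ y) b (head-fresh c (x ++ y) d) (∈-++⁺ʳ x b∈y) (sym b≡c)))
  (distinct-right∉left x y b (tail-distinct c (x ++ y) d) b∈y)

-- Pigeonhole: a distinct list with entries in (lo, lo + M] has at most M entries.  The top
-- value t = lo + M + 1 is removed, which loses at most one entry.
module Pigeonhole where

  keep : ℕ → ℕ → Bool
  keep t e = not (e ≡ᵇ t)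

  remove-absent : ∀ t xs → any (t ≡ᵇ_) xs ≡ false → length (filterᵇ (keep t) xs) ≡ length xs
  remove-absent t []       _ = refl
  remove-absent t (x ∷ xs) absent with x ≡ᵇ t in x≡t
  ... | true  = ⊥-elim (∉-entries t (x ∷ xs) x absent (here refl) (sym (≡ᵇ-true x t x≡t)))
  ... | false = cong suc (remove-absent t xs (∨-false₂ {t ≡ᵇ x} absent))

  remove-length : ∀ t xs → distinct xs ≡ true → length xs ≤ suc (length (filterᵇ (keep t) xs))
  remove-length t []       d = z≤n
  remove-length t (x ∷ xs) d with x ≡ᵇ t in x≡t
  ... | true  = s≤s (≤-reflexive (sym (remove-absent t xs
                  (subst (λ s → any (s ≡ᵇ_) xs ≡ false) (≡ᵇ-true x t x≡t) (head-fresh x xs d)))))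
  ... | false = s≤s (remove-length t xs (tail-distinct x xs d))

  filter-absent : ∀ (P : ℕ → Bool) a xs → any (a ≡ᵇ_) xs ≡ false → any (a ≡ᵇ_) (filterᵇ P xs) ≡ false
  filter-absent P a []       _      = refl
  filter-absent P a (x ∷ xs) absent with P x
  ... | true  = cong₂ _∨_ (∨-false₁ absent) (filter-absent P a xs (∨-false₂ {a ≡ᵇ x} absent))
  ... | false = filter-absent P a xs (∨-false₂ {a ≡ᵇ x} absent)

  filter-distinct : ∀ (P : ℕ → Bool) xs → distinct xs ≡ true → distinct (filterᵇ P xs) ≡ true
  filter-distinct P []       d = refl
  filter-distinct P (x ∷ xs) d with P x
  ... | true  = cong₂ _∧_ (cong not (filter-absent P x xs (head-fresh x xs d))) (filter-distinct P xs (tail-distinct x xs d))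
  ... | false = filter-distinct P xs (tail-distinct x xs d)

  filter-All : ∀ {Q R : ℕ → Set} (P : ℕ → Bool) xs → (∀ e → Q e → P e ≡ true → R e) → All Q xs → All R (filterᵇ P xs)
  filter-All P []       f []       = []
  filter-All P (x ∷ xs) f (q ∷ qs) with P x in px
  ... | true  = f x q px ∷ filter-All P xs f qs
  ... | false = filter-All P xs f qs

  pigeonhole : ∀ M lo xs → distinct xs ≡ true → All (λ e → lo < e × e ≤ lo + M) xs → length xs ≤ M
  pigeonhole zero    lo []       d _                    = z≤n
  pigeonhole zero    lo (x ∷ xs) d ((lo<x , x≤lo) ∷ _) = ⊥-elim (<⇒≱ lo<x (subst (x ≤_) (+-identityʳ lo) x≤lo))
  pigeonhole (suc M) lo xs d inRange = ≤-trans (remove-length t xs d)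
    (s≤s (pigeonhole M lo (filterᵇ (keep t) xs) (filter-distinct (keep t) xs d) (filter-All (keep t) xs lower inRange)))
    where
    t = lo + suc M
    lower : ∀ e → lo < e × e ≤ t → keep t e ≡ true → lo < e × e ≤ lo + M
    lower e (lo<e , e≤t) e≢t = lo<e , ≤-pred (subst (e <_) (+-suc lo M) (≤∧≢⇒< e≤t e≠t))
      where
      e≠t : e ≢ t
      e≠t refl = true≢false (trans (sym (≡ᵇ-refl e)) (not-true e≢t))

open Pigeonhole using (pigeonhole)

no231⇒right-not-below : ∀ v x y a → a ∈ x → v < a → occurs231After v (x ++ y) ≡ false → any (_<ᵇ v) y ≡ false
no231⇒right-not-below v (a ∷ x) y .a (here refl) v<a no231 =
  ∨-false₂ {any (_<ᵇ v) x} (trans (sym (any-++ (_<ᵇ v) x y))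
    (trans (sym (∧-identityʳ _)) (trans (cong (any (_<ᵇ v) (x ++ y) ∧_) (sym (<⇒<ᵇ-true v<a))) (∨-false₁ no231))))
no231⇒right-not-below v (b ∷ x) y a (there a∈x) v<a no231 =
  no231⇒right-not-below v x y a a∈x v<a (∨-false₂ {any (_<ᵇ v) (x ++ y) ∧ (v <ᵇ b)} no231)

-- Let σ = v ∷ x ++ y be distinct with entries in [1, v + |y|],
-- where v = |x| + 1.  If v is not the "2" of a 231 then every entry of x is below v: an
-- entry a > v would force all of y above v, and a ∷ y would be |y| + 1 distinct values
-- in (v, v + |y|].
first-block-below : ∀ x y → distinct (suc (length x) ∷ x ++ y) ≡ true →
  occurs231After (suc (length x)) (x ++ y) ≡ false →
  All (_≤ suc (length x) + length y) (x ++ y) → allBelow (suc (length x)) x ≡ true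
first-block-below x y d no231 small with allBelow (suc (length x)) x in eq
... | true  = refl
... | false with ¬all⇒witness (_<ᵇ suc (length x)) x eq
...   | a , a∈x , a≮v = ⊥-elim (<-irrefl refl (pigeonhole (length y) v (a ∷ y) distinct-ay in-range))
  where
  v = suc (length x)
  v∉ : any (v ≡ᵇ_) (x ++ y) ≡ false
  v∉ = head-fresh v (x ++ y) d
  d′ : distinct (x ++ y) ≡ true
  d′ = tail-distinct v (x ++ y) d
  v<a : v < a
  v<a = ≤∧≢⇒< (<ᵇ-false a v a≮v) (∉-entries v (x ++ y) a v∉ (∈-++⁺ˡ a∈x))
  distinct-ay : distinct (a ∷ y) ≡ true
  distinct-ay = cong₂ _∧_ (cong not (distinct-left∉right x y a d′ a∈x)) (distinct-suffix x y d′)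
  y-above : ∀ e → (e <ᵇ v) ≡ false → (v ≡ᵇ e) ≡ false → e ≤ v + length y → v < e × e ≤ v + length y
  y-above e e≮v v≢e e≤ = ≤∧≢⇒< (<ᵇ-false e v e≮v) (λ { refl → true≢false (trans (sym (≡ᵇ-refl v)) v≢e) }) , e≤
  in-range : All (λ e → v < e × e ≤ v + length y) (a ∷ y)
  in-range = (v<a , All.lookup (proj₁ (++⁻ x small)) a∈x) ∷
    All.zipWith (λ ((e≮v , v≢e) , e≤) → y-above _ e≮v v≢e e≤)
      (All.zip (¬any⇒All (_<ᵇ v) y (no231⇒right-not-below v x y a a∈x v<a no231) ,
                ¬any⇒All (v ≡ᵇ_) y (∨-false₂ {any (v ≡ᵇ_) x} (trans (sym (any-++ (v ≡ᵇ_) x y)) v∉))) ,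
       proj₂ (++⁻ x small))

-- Once x lies below v, every entry of y lies above v: an entry b < v together with x
-- would give |x| + 1 distinct values in [1, |x|].
second-block-above : ∀ x y → distinct (suc (length x) ∷ x ++ y) ≡ true → All (1 ≤_) (x ++ y) →
  allBelow (suc (length x)) x ≡ true → allAbove (suc (length x)) y ≡ true
second-block-above x y d positive below with allAbove (suc (length x)) y in eq
... | true  = refl
... | false with ¬all⇒witness (suc (length x) <ᵇ_) y eq
...   | b , b∈y , v≮b = ⊥-elim (<-irrefl refl (pigeonhole (length x) 0 (b ∷ x) distinct-bx in-range))
  where
  v = suc (length x)
  b<v : b < v
  b<v = ≤∧≢⇒< (<ᵇ-false v b v≮b) (λ b≡v → ∉-entries v (x ++ y) b (head-fresh v (x ++ y) d) (∈-++⁺ʳ x b∈y) (sym b≡v))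
  d′ : distinct (x ++ y) ≡ true
  d′ = tail-distinct v (x ++ y) d
  distinct-bx : distinct (b ∷ x) ≡ true
  distinct-bx = cong₂ _∧_ (cong not (distinct-right∉left x y b d′ b∈y)) (distinct-prefix x y d′)
  in-range : All (λ e → 0 < e × e ≤ 0 + length x) (b ∷ x)
  in-range = (All.lookup (proj₂ (++⁻ x positive)) b∈y , ≤-pred b<v) ∷
    All.zipWith (λ (1≤e , e<v) → 1≤e , ≤-pred (<ᵇ-true _ v e<v)) (proj₁ (++⁻ x positive) , all⇒All (_<ᵇ v) x below)

wordSum : ℕ → ℕ → (List ℕ → ℕ) → ℕ
wordSum m N F = ΣL F (words m N)

Letter : ℕ → ℕ → Set
Letter N e = 1 ≤ e × e ≤ N

wordSum-suc : ∀ m N F → wordSum (suc m) N F ≡ Σ< N (λ t → wordSum m N (λ w → F (suc t ∷ w)))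
wordSum-suc m N F = trans (ΣL-concatMap F (λ v → map (v ∷_) (words m N)) (range 1 N))
  (trans (ΣL-applyUpTo (λ v → ΣL F (map (v ∷_) (words m N))) suc N)
    (Σ-ext N (λ t → ΣL-map F (suc t ∷_) (words m N))))

wordSum-cong : ∀ m N {F G : List ℕ → ℕ} → (∀ w → length w ≡ m → All (Letter N) w → F w ≡ G w) →
  wordSum m N F ≡ wordSum m N G
wordSum-cong zero    N eq = cong (_+ 0) (eq [] refl [])
wordSum-cong (suc m) N {F} {G} eq = trans (wordSum-suc m N F) (trans
  (Σ-cong N (λ t t<N → wordSum-cong m N (λ w |w| ws → eq (suc t ∷ w) (cong suc |w|) ((s≤s z≤n , t<N) ∷ ws))))
  (sym (wordSum-suc m N G)))

wordSum-split : ∀ a b N F → wordSum (a + b) N F ≡ wordSum a N (λ x → wordSum b N (λ y → F (x ++ y)))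
wordSum-split zero    b N F = sym (+-identityʳ _)
wordSum-split (suc a) b N F = trans (wordSum-suc (a + b) N F) (trans
  (Σ-ext N (λ t → wordSum-split a b N (λ w → F (suc t ∷ w))))
  (sym (wordSum-suc a N (λ x → wordSum b N (λ y → F (x ++ y))))))

wordSum-zero : ∀ m N F → (∀ w → F w ≡ 0) → wordSum m N F ≡ 0
wordSum-zero m N F = ΣL-zero F (words m N)

wordSum-*ˡ : ∀ m N K F → wordSum m N (λ w → K * F w) ≡ K * wordSum m N F
wordSum-*ˡ m N K F = ΣL-*ˡ F K (words m N)

wordSum-*ʳ : ∀ m N K F → wordSum m N (λ w → F w * K) ≡ wordSum m N F * K
wordSum-*ʳ m N K F = ΣL-*ʳ F K (words m N)

wordSum-Σ : ∀ m N n (G : ℕ → List ℕ → ℕ) → wordSum m N (λ w → Σ< n (λ a → G a w)) ≡ Σ< n (λ a → wordSum m N (G a))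
wordSum-Σ m N n G = ΣL-Σ n G (words m N)

wordSum-restrict : ∀ m M N F → M ≤ N → (∀ w → Any (M <_) w → F w ≡ 0) → wordSum m N F ≡ wordSum m M F
wordSum-restrict zero    M N F M≤N vanish = refl
wordSum-restrict (suc m) M N F M≤N vanish = begin
  wordSum (suc m) N F
    ≡⟨ wordSum-suc m N F ⟩
  Σ< N (λ t → wordSum m N (λ w → F (suc t ∷ w)))
    ≡⟨ Σ-extend M N (λ t → wordSum m N (λ w → F (suc t ∷ w))) M≤N
         (λ t M≤t _ → wordSum-zero m N (λ w → F (suc t ∷ w)) (λ w → vanish (suc t ∷ w) (here (s≤s M≤t)))) ⟩
  Σ< M (λ t → wordSum m N (λ w → F (suc t ∷ w)))
    ≡⟨ Σ-ext M (λ t → wordSum-restrict m M N (λ w → F (suc t ∷ w)) M≤N (λ w big → vanish (suc t ∷ w) (there big))) ⟩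
  Σ< M (λ t → wordSum m M (λ w → F (suc t ∷ w)))
    ≡⟨ sym (wordSum-suc m M F) ⟩
  wordSum (suc m) M F ∎

wordSum-shift : ∀ m s M F → (∀ w → Any (_≤ s) w → F w ≡ 0) → wordSum m (s + M) F ≡ wordSum m M (λ z → F (map (s +_) z))
wordSum-shift zero    s M F vanish = refl
wordSum-shift (suc m) s M F vanish = begin
  wordSum (suc m) (s + M) F
    ≡⟨ wordSum-suc m (s + M) F ⟩
  Σ< (s + M) (λ t → wordSum m (s + M) (λ w → F (suc t ∷ w)))
    ≡⟨ Σ-split s M (λ t → wordSum m (s + M) (λ w → F (suc t ∷ w))) ⟩
  Σ< s (λ t → wordSum m (s + M) (λ w → F (suc t ∷ w))) + Σ< M (λ t → wordSum m (s + M) (λ w → F (suc (s + t) ∷ w)))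
    ≡⟨ cong₂ _+_ (Σ-zero s (λ t t<s → wordSum-zero m (s + M) (λ w → F (suc t ∷ w)) (λ w → vanish (suc t ∷ w) (here t<s))))
          (Σ-ext M (λ t → wordSum-shift m s M (λ w → F (suc (s + t) ∷ w)) (λ w small → vanish (suc (s + t) ∷ w) (there small)))) ⟩
  0 + Σ< M (λ t → wordSum m M (λ z → F (suc (s + t) ∷ map (s +_) z)))
    ≡⟨ Σ-ext M (λ t → cong (λ u → wordSum m M (λ z → F (u ∷ map (s +_) z))) (sym (+-suc s t))) ⟩
  Σ< M (λ t → wordSum m M (λ z → F (map (s +_) (suc t ∷ z))))
    ≡⟨ sym (wordSum-suc m M (λ z → F (map (s +_) z))) ⟩
  wordSum (suc m) M (λ z → F (map (s +_) z)) ∎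

admissible : ℕ → ℕ → List ℕ → Bool
admissible p k σ = distinct σ ∧ (not (has231 σ) ∧ bounded p k σ)

-- Indicator of an admissible word with exactly j descents, and the resulting counts among
-- the words of length n over [1 .. n] (that is, among the permutations of [n]).
counted : ℕ → ℕ → ℕ → List ℕ → ℕ
counted p k j σ = ι (admissible p k σ ∧ (descents σ ≡ᵇ j))

count : ℕ → ℕ → ℕ → ℕ → ℕ
count p k n j = wordSum n n (counted p k j)

admissible-split : ∀ p k x y → allBelow (suc (length x)) x ≡ true → allAbove (suc (length x)) y ≡ true →
  admissible p k (suc (length x) ∷ x ++ y)
    ≡ ((suc p ∸ suc (length x)) ≤ᵇ k) ∧ (admissible (suc p) k x ∧ admissible (p + suc (length x)) k y)
admissible-split p k x y below above = begin
  (not (any (v ≡ᵇ_) (x ++ y)) ∧ distinct (x ++ y)) ∧ (not (occurs231After v (x ++ y) ∨ has231 (x ++ y)) ∧ (B ∧ bounded (suc p) k (x ++ y)))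
    ≡⟨ cong₂ (λ s t → (not s ∧ t) ∧ (not (occurs231After v (x ++ y) ∨ has231 (x ++ y)) ∧ (B ∧ bounded (suc p) k (x ++ y))))
             v-fresh (distinct-++ v x y below above) ⟩
  (distinct x ∧ distinct y) ∧ (not (occurs231After v (x ++ y) ∨ has231 (x ++ y)) ∧ (B ∧ bounded (suc p) k (x ++ y)))
    ≡⟨ cong₂ (λ s t → (distinct x ∧ distinct y) ∧ (not (s ∨ t) ∧ (B ∧ bounded (suc p) k (x ++ y))))
             (trans (occurs231After-below-++ v x y below) (occurs231After-above v y above)) (has231-++ v x y below above) ⟩
  (distinct x ∧ distinct y) ∧ (not (has231 x ∨ has231 y) ∧ (B ∧ bounded (suc p) k (x ++ y)))
    ≡⟨ cong (λ s → (distinct x ∧ distinct y) ∧ (not (has231 x ∨ has231 y) ∧ (B ∧ s)))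
            (trans (bounded-++ (suc p) k x y) (cong (λ t → bounded (suc p) k x ∧ bounded t k y) (sym (+-suc p (length x))))) ⟩
  (distinct x ∧ distinct y) ∧ (not (has231 x ∨ has231 y) ∧ (B ∧ (bounded (suc p) k x ∧ bounded (p + v) k y)))
    ≡⟨ regroup (distinct x) (distinct y) (has231 x) (has231 y) B (bounded (suc p) k x) (bounded (p + v) k y) ⟩
  B ∧ (admissible (suc p) k x ∧ admissible (p + v) k y) ∎
  where
  v = suc (length x)
  B = (suc p ∸ v) ≤ᵇ k
  v-fresh : any (v ≡ᵇ_) (x ++ y) ≡ false
  v-fresh = trans (any-++ (v ≡ᵇ_) x y) (cong₂ _∨_ (notInBelow v x below) (notInAbove v y above))
  regroup : ∀ dx dy cx cy B bx by → (dx ∧ dy) ∧ (not (cx ∨ cy) ∧ (B ∧ (bx ∧ by)))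
                                    ≡ B ∧ ((dx ∧ (not cx ∧ bx)) ∧ (dy ∧ (not cy ∧ by)))
  regroup false dy cx    cy B     bx    by = sym (∧-zeroʳ B)
  regroup true  dy true  cy B     bx    by = trans (∧-zeroʳ dy) (sym (∧-zeroʳ B))
  regroup true  dy false cy false bx    by = trans (cong (dy ∧_) (∧-zeroʳ (not cy))) (∧-zeroʳ dy)
  regroup true  dy false cy true  false by = trans (cong (dy ∧_) (∧-zeroʳ (not cy))) (∧-zeroʳ dy)
  regroup true  dy false cy true  true  by = refl

admissible⇒separated : ∀ p k x y → admissible p k (suc (length x) ∷ x ++ y) ≡ true →
  All (Letter (suc (length x) + length y)) (x ++ y) →
  allBelow (suc (length x)) x ≡ true × allAbove (suc (length x)) y ≡ true
admissible⇒separated p k x y adm letters =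
  below , second-block-above x y d (All.map proj₁ letters) below
  where
  v = suc (length x)
  d = ∧-true₁ {distinct (v ∷ x ++ y)} adm
  no231 : has231 (v ∷ x ++ y) ≡ false
  no231 = not-true (∧-true₁ {not (has231 (v ∷ x ++ y))} (∧-true₂ {distinct (v ∷ x ++ y)} adm))
  below = first-block-below x y d (∨-false₁ {occurs231After v (x ++ y)} no231) (All.map proj₂ letters)

lowBlock : ℕ → ℕ → ℕ → List ℕ → Bool
lowBlock p k v x = admissible (suc p) k x ∧ allBelow v x

highBlock : ℕ → ℕ → ℕ → List ℕ → Bool
highBlock q k v y = admissible q k y ∧ allAbove v y

-- For letters in range, admissibility of v ∷ x ++ y always factors through the two
-- blocks: when v does not separate x from y, both sides are false.
admissible-first : ∀ p k x y → All (Letter (suc (length x) + length y)) (x ++ y) →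
  admissible p k (suc (length x) ∷ x ++ y)
    ≡ ((suc p ∸ suc (length x)) ≤ᵇ k) ∧ (lowBlock p k (suc (length x)) x ∧ highBlock (p + suc (length x)) k (suc (length x)) y)
admissible-first p k x y letters with allBelow (suc (length x)) x in below | allAbove (suc (length x)) y in above
... | true  | true  = trans (admissible-split p k x y below above)
  (cong₂ (λ s t → ((suc p ∸ suc (length x)) ≤ᵇ k) ∧ (s ∧ t))
         (sym (∧-identityʳ (admissible (suc p) k x))) (sym (∧-identityʳ (admissible (p + suc (length x)) k y))))
... | false | a     = trans
  (refute (λ adm → true≢false (trans (sym (proj₁ (admissible⇒separated p k x y adm letters))) below)))
  (sym (low-false ((suc p ∸ suc (length x)) ≤ᵇ k) (admissible (suc p) k x) (admissible (p + suc (length x)) k y ∧ a)))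
  where
  low-false : ∀ B A H → B ∧ ((A ∧ false) ∧ H) ≡ false
  low-false B A H = trans (cong (λ s → B ∧ (s ∧ H)) (∧-zeroʳ A)) (∧-zeroʳ B)
... | true  | false = trans
  (refute (λ adm → true≢false (trans (sym (proj₂ (admissible⇒separated p k x y adm letters))) above)))
  (sym (high-false ((suc p ∸ suc (length x)) ≤ᵇ k) (admissible (suc p) k x ∧ true) (admissible (p + suc (length x)) k y)))
  where
  high-false : ∀ B L A → B ∧ (L ∧ (A ∧ false)) ≡ false
  high-false B L A = trans (cong (λ s → B ∧ (L ∧ s)) (∧-zeroʳ A)) (trans (cong (B ∧_) (∧-zeroʳ L)) (∧-zeroʳ B))

lowCount : ℕ → ℕ → ℕ → List ℕ → ℕ → ℕ
lowCount p k v x a = ι (lowBlock p k v x ∧ (descents x ≡ᵇ a))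

highCount : ℕ → ℕ → ℕ → List ℕ → ℕ → ℕ
highCount q k v y b = ι (highBlock q k v y ∧ (descents y ≡ᵇ b))

∧-guard : ∀ a {b c} → (a ≡ true → b ≡ c) → a ∧ b ≡ a ∧ c
∧-guard true  eq = eq refl
∧-guard false _  = refl

Σ-indicator : ∀ n d (G : ℕ → ℕ) → d < n → Σ< n (λ a → ι (d ≡ᵇ a) * G a) ≡ G d
Σ-indicator (suc n) zero    G _         = trans (cong (G 0 + 0 +_) (Σ-zero n (λ a _ → refl))) (trans (+-identityʳ _) (+-identityʳ _))
Σ-indicator (suc n) (suc d) G (s≤s d<n) = Σ-indicator n d (λ a → G (suc a)) d<n

Σ-indicator-out : ∀ n d (G : ℕ → ℕ) → n ≤ d → Σ< n (λ a → ι (d ≡ᵇ a) * G a) ≡ 0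
Σ-indicator-out zero    d       G _         = refl
Σ-indicator-out (suc n) (suc d) G (s≤s n≤d) = Σ-indicator-out n d (λ a → G (suc a)) n≤d

≡ᵇ-∸ : ∀ d₁ d₂ J → d₁ ≤ J → (d₁ + d₂ ≡ᵇ J) ≡ (d₂ ≡ᵇ J ∸ d₁)
≡ᵇ-∸ zero     d₂ J       _         = refl
≡ᵇ-∸ (suc d₁) d₂ (suc J) (s≤s d≤J) = ≡ᵇ-∸ d₁ d₂ J d≤J

descent-convolution : ∀ c₁ c₂ d₁ d₂ J →
  ι ((c₁ ∧ c₂) ∧ (d₁ + d₂ ≡ᵇ J)) ≡ Σ< (suc J) (λ a → ι (c₁ ∧ (d₁ ≡ᵇ a)) * ι (c₂ ∧ (d₂ ≡ᵇ J ∸ a)))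
descent-convolution c₁ c₂ d₁ d₂ J = sym (begin
  Σ< (suc J) (λ a → ι (c₁ ∧ (d₁ ≡ᵇ a)) * ι (c₂ ∧ (d₂ ≡ᵇ J ∸ a)))
    ≡⟨ Σ-ext (suc J) (λ a → trans (cong₂ _*_ (ι-∧ c₁ (d₁ ≡ᵇ a)) (ι-∧ c₂ (d₂ ≡ᵇ J ∸ a)))
                                  (interchange (ι c₁) (ι (d₁ ≡ᵇ a)) (ι c₂) (ι (d₂ ≡ᵇ J ∸ a)))) ⟩
  Σ< (suc J) (λ a → (ι c₁ * ι c₂) * (ι (d₁ ≡ᵇ a) * ι (d₂ ≡ᵇ J ∸ a)))
    ≡⟨ Σ-*ˡ (suc J) (ι c₁ * ι c₂) (λ a → ι (d₁ ≡ᵇ a) * ι (d₂ ≡ᵇ J ∸ a)) ⟩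
  (ι c₁ * ι c₂) * Σ< (suc J) (λ a → ι (d₁ ≡ᵇ a) * ι (d₂ ≡ᵇ J ∸ a))
    ≡⟨ cong₂ _*_ (sym (ι-∧ c₁ c₂)) split ⟩
  ι (c₁ ∧ c₂) * ι (d₁ + d₂ ≡ᵇ J)
    ≡⟨ sym (ι-∧ (c₁ ∧ c₂) (d₁ + d₂ ≡ᵇ J)) ⟩
  ι ((c₁ ∧ c₂) ∧ (d₁ + d₂ ≡ᵇ J)) ∎)
  where
  interchange : ∀ a b c d → (a * b) * (c * d) ≡ (a * c) * (b * d)
  interchange = solve-∀
  split : Σ< (suc J) (λ a → ι (d₁ ≡ᵇ a) * ι (d₂ ≡ᵇ J ∸ a)) ≡ ι (d₁ + d₂ ≡ᵇ J)
  split with d₁ ≤? J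
  ... | yes d₁≤J = trans (Σ-indicator (suc J) d₁ (λ a → ι (d₂ ≡ᵇ J ∸ a)) (s≤s d₁≤J)) (cong ι (sym (≡ᵇ-∸ d₁ d₂ J d₁≤J)))
  ... | no  d₁≰J = trans (Σ-indicator-out (suc J) d₁ (λ a → ι (d₂ ≡ᵇ J ∸ a)) (≰⇒> d₁≰J))
                         (sym (cong ι (≢⇒≡ᵇ-false (λ eq → d₁≰J (subst (d₁ ≤_) eq (m≤m+n d₁ d₂))))))

-- Pointwise form of the first-entry decomposition.  First entry 1: no descent is created
-- and the rest is a block above 1.
counted-first-one : ∀ p k j y → All (Letter (suc (length y))) y →
  counted p k j (1 ∷ y) ≡ ι (p ≤ᵇ k) * highCount (p + 1) k 1 y j
counted-first-one p k j y letters = begin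
  ι (admissible p k (1 ∷ y) ∧ (descents (1 ∷ y) ≡ᵇ j))
    ≡⟨ cong (λ s → ι (s ∧ (descents (1 ∷ y) ≡ᵇ j))) (admissible-first p k [] y letters) ⟩
  ι ((B ∧ H) ∧ (descents (1 ∷ y) ≡ᵇ j))
    ≡⟨ cong ι (∧-assoc B H _) ⟩
  ι (B ∧ (H ∧ (descents (1 ∷ y) ≡ᵇ j)))
    ≡⟨ ι-∧ B _ ⟩
  ι B * ι (H ∧ (descents (1 ∷ y) ≡ᵇ j))
    ≡⟨ cong (λ s → ι B * ι s) (∧-guard H (λ ok → cong (_≡ᵇ j) (no-descent y (∧-true₂ {admissible (p + 1) k y} ok)))) ⟩
  ι B * highCount (p + 1) k 1 y j ∎
  where
  B = p ≤ᵇ k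
  H = highBlock (p + 1) k 1 y
  no-descent : ∀ y → allAbove 1 y ≡ true → descents (1 ∷ y) ≡ descents y
  no-descent []      _     = refl
  no-descent (b ∷ y) above = cong (λ t → ι t + descents (b ∷ y)) (≥⇒<ᵇ-false (<⇒≤ (<ᵇ-true 1 b (∧-true₁ above))))

-- First entry v = |x| + 1 ≥ 2 with x nonempty: v is a descent top, and the descents of the
-- two blocks add up to the remaining ones.
counted-first-high : ∀ p k j x₀ x′ y → All (Letter (suc (length (x₀ ∷ x′)) + length y)) ((x₀ ∷ x′) ++ y) →
  counted p k j (suc (length (x₀ ∷ x′)) ∷ (x₀ ∷ x′) ++ y)
    ≡ ι ((suc p ∸ suc (length (x₀ ∷ x′))) ≤ᵇ k)
      * glue (lowCount p k (suc (length (x₀ ∷ x′))) (x₀ ∷ x′))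
             (highCount (p + suc (length (x₀ ∷ x′))) k (suc (length (x₀ ∷ x′))) y) j
counted-first-high p k j x₀ x′ y letters = begin
  ι (admissible p k (v ∷ x ++ y) ∧ (descents (v ∷ x ++ y) ≡ᵇ j))
    ≡⟨ cong (λ s → ι (s ∧ (descents (v ∷ x ++ y) ≡ᵇ j))) (admissible-first p k x y letters) ⟩
  ι ((B ∧ (L ∧ H)) ∧ (descents (v ∷ x ++ y) ≡ᵇ j))
    ≡⟨ cong ι (∧-assoc B (L ∧ H) _) ⟩
  ι (B ∧ ((L ∧ H) ∧ (descents (v ∷ x ++ y) ≡ᵇ j)))
    ≡⟨ ι-∧ B _ ⟩
  ι B * ι ((L ∧ H) ∧ (descents (v ∷ x ++ y) ≡ᵇ j))
    ≡⟨ cong (λ s → ι B * ι s) (∧-guard (L ∧ H) (λ ok → cong (_≡ᵇ j) (one-more-descent ok))) ⟩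
  ι B * ι ((L ∧ H) ∧ (suc (descents x + descents y) ≡ᵇ j))
    ≡⟨ cong (ι B *_) (as-glue j) ⟩
  ι B * glue (lowCount p k v x) (highCount (p + v) k v y) j ∎
  where
  x = x₀ ∷ x′
  v = suc (length x)
  B = (suc p ∸ v) ≤ᵇ k
  L = lowBlock p k v x
  H = highBlock (p + v) k v y
  one-more-descent : L ∧ H ≡ true → descents (v ∷ x ++ y) ≡ suc (descents x + descents y)
  one-more-descent ok = trans (cong (λ t → ι t + descents (x ++ y)) (∧-true₁ {x₀ <ᵇ v} below))
                              (cong suc (descents-++ v x y below above))
    where
    below = ∧-true₂ {admissible (suc p) k x} (∧-true₁ ok)
    above = ∧-true₂ {admissible (p + v) k y} (∧-true₂ {L} ok)
  as-glue : ∀ j → ι ((L ∧ H) ∧ (suc (descents x + descents y) ≡ᵇ j)) ≡ glue (lowCount p k v x) (highCount (p + v) k v y) j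
  as-glue zero    = cong ι (∧-zeroʳ (L ∧ H))
  as-glue (suc J) = descent-convolution L H (descents x) (descents y) J

-- Translating all letters preserves admissibility, with the offset shifted accordingly;
-- so a high block above v, shifted down by v, is an admissible word at offset p.
admissible-shift : ∀ s q k z → admissible (q + s) k (map (s +_) z) ≡ admissible q k z
admissible-shift s q k z =
  cong₂ _∧_ (distinct-shift s z) (cong₂ (λ a b → not a ∧ b) (has231-shift s z) (bounded-shift s q k z))

highCount-shift : ∀ p k v b z → All (1 ≤_) z → highCount (p + v) k v (map (v +_) z) b ≡ counted p k b z
highCount-shift p k v b z positive = cong ι (trans
  (cong₂ (λ s t → (s ∧ t) ∧ (descents (map (v +_) z) ≡ᵇ b)) (admissible-shift v p k z) (allAbove-shift v z positive))
  (cong₂ (λ s t → s ∧ (t ≡ᵇ b)) (∧-identityʳ (admissible p k z)) (descents-shift v z)))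

highCount-low-letter : ∀ q k v y b → Any (_≤ v) y → highCount q k v y b ≡ 0
highCount-low-letter q k v y b low = trans
  (cong (λ t → ι ((admissible q k y ∧ t) ∧ (descents y ≡ᵇ b))) (not-all low))
  (cong (λ s → ι (s ∧ (descents y ≡ᵇ b))) (∧-zeroʳ (admissible q k y)))
  where
  not-all : ∀ {y} → Any (_≤ v) y → allAbove v y ≡ false
  not-all {e ∷ y} (here e≤v)  = cong (_∧ allAbove v y) (≥⇒<ᵇ-false e≤v)
  not-all {e ∷ y} (there low) = trans (cong ((v <ᵇ e) ∧_) (not-all low)) (∧-zeroʳ (v <ᵇ e))

lowCount-in-range : ∀ p k M x a → All (Letter M) x → lowCount p k (suc M) x a ≡ counted (suc p) k a x
lowCount-in-range p k M x a letters = cong ι (cong (_∧ (descents x ≡ᵇ a))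
  (trans (cong (admissible (suc p) k x ∧_) (all-below letters)) (∧-identityʳ (admissible (suc p) k x))))
  where
  all-below : ∀ {x} → All (Letter M) x → allBelow (suc M) x ≡ true
  all-below []                 = refl
  all-below ((_ , e≤M) ∷ rest) = cong₂ _∧_ (<⇒<ᵇ-true (s≤s e≤M)) (all-below rest)

lowCount-high-letter : ∀ p k M x a → Any (M <_) x → lowCount p k (suc M) x a ≡ 0
lowCount-high-letter p k M x a high = trans
  (cong (λ t → ι ((admissible (suc p) k x ∧ t) ∧ (descents x ≡ᵇ a))) (not-all high))
  (cong (λ s → ι (s ∧ (descents x ≡ᵇ a))) (∧-zeroʳ (admissible (suc p) k x)))
  where
  not-all : ∀ {x} → Any (M <_) x → allBelow (suc M) x ≡ false
  not-all {e ∷ x} (here M<e)  = cong (_∧ allBelow (suc M) x) (≥⇒<ᵇ-false M<e)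
  not-all {e ∷ x} (there big) = trans (cong ((e <ᵇ suc M) ∧_) (not-all big)) (∧-zeroʳ (e <ᵇ suc M))

Letter⇒positive : ∀ {N} z → All (Letter N) z → All (1 ≤_) z
Letter⇒positive z = All.map proj₁

wordSum-glue : ∀ m r N (F G : List ℕ → ℕ → ℕ) j →
  wordSum m N (λ x → wordSum r N (λ y → glue (F x) (G y) j))
    ≡ glue (λ a → wordSum m N (λ x → F x a)) (λ b → wordSum r N (λ y → G y b)) j
wordSum-glue m r N F G zero    = wordSum-zero m N _ (λ x → wordSum-zero r N _ (λ y → refl))
wordSum-glue m r N F G (suc J) = begin
  wordSum m N (λ x → wordSum r N (λ y → Σ< (suc J) (λ a → F x a * G y (J ∸ a))))
    ≡⟨ wordSum-cong m N (λ x _ _ → trans (wordSum-Σ r N (suc J) (λ a y → F x a * G y (J ∸ a)))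
                                         (Σ-ext (suc J) (λ a → wordSum-*ˡ r N (F x a) (λ y → G y (J ∸ a))))) ⟩
  wordSum m N (λ x → Σ< (suc J) (λ a → F x a * wordSum r N (λ y → G y (J ∸ a))))
    ≡⟨ wordSum-Σ m N (suc J) (λ a x → F x a * wordSum r N (λ y → G y (J ∸ a))) ⟩
  Σ< (suc J) (λ a → wordSum m N (λ x → F x a * wordSum r N (λ y → G y (J ∸ a))))
    ≡⟨ Σ-ext (suc J) (λ a → wordSum-*ʳ m N (wordSum r N (λ y → G y (J ∸ a))) (λ x → F x a)) ⟩
  Σ< (suc J) (λ a → wordSum m N (λ x → F x a) * wordSum r N (λ y → G y (J ∸ a))) ∎

count-first-one : ∀ p k m j → wordSum m (suc m) (λ w → counted p k j (1 ∷ w)) ≡ ι (p ≤ᵇ k) * count p k m j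
count-first-one p k m j = begin
  wordSum m (suc m) (λ w → counted p k j (1 ∷ w))
    ≡⟨ wordSum-cong m (suc m) (λ y |y| letters →
         counted-first-one p k j y (subst (λ t → All (Letter (suc t)) y) (sym |y|) letters)) ⟩
  wordSum m (suc m) (λ y → ι (p ≤ᵇ k) * highCount (p + 1) k 1 y j)
    ≡⟨ wordSum-*ˡ m (suc m) (ι (p ≤ᵇ k)) (λ y → highCount (p + 1) k 1 y j) ⟩
  ι (p ≤ᵇ k) * wordSum m (suc m) (λ y → highCount (p + 1) k 1 y j)
    ≡⟨ cong (ι (p ≤ᵇ k) *_) (wordSum-shift m 1 m (λ y → highCount (p + 1) k 1 y j)
                                             (λ y low → highCount-low-letter (p + 1) k 1 y j low)) ⟩
  ι (p ≤ᵇ k) * wordSum m m (λ z → highCount (p + 1) k 1 (map (1 +_) z) j)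
    ≡⟨ cong (ι (p ≤ᵇ k) *_) (wordSum-cong m m (λ z _ letters → highCount-shift p k 1 j z (Letter⇒positive z letters))) ⟩
  ι (p ≤ᵇ k) * count p k m j ∎

-- Words of length m+1 starting with v = u+2: the next u+1 letters form the low block.
module FirstEntryHigh (p k m u : ℕ) (u<m : u < m) where

  r = m ∸ suc u
  v = suc (suc u)
  B = (p ∸ suc u) ≤ᵇ k

  m≡ : suc u + r ≡ m
  m≡ = m+[n∸m]≡n u<m

  pointwise : ∀ j x y → length x ≡ suc u → length y ≡ r → All (Letter (suc m)) x → All (Letter (suc m)) y →
    counted p k j (v ∷ x ++ y) ≡ ι B * glue (lowCount p k v x) (highCount (p + v) k v y) j
  pointwise j (x₀ ∷ x′) y refl |y| lx ly = counted-first-high p k j x₀ x′ y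
    (subst (λ t → All (Letter t) ((x₀ ∷ x′) ++ y)) (cong suc (trans (sym m≡) (cong (suc u +_) (sym |y|)))) (++⁺ lx ly))

  low-sum : ∀ a → wordSum (suc u) (suc m) (λ x → lowCount p k v x a) ≡ count (suc p) k (suc u) a
  low-sum a = trans
    (wordSum-restrict (suc u) (suc u) (suc m) (λ x → lowCount p k v x a) (≤-trans u<m (n≤1+n m))
                      (λ x high → lowCount-high-letter p k (suc u) x a high))
    (wordSum-cong (suc u) (suc u) (λ x _ letters → lowCount-in-range p k (suc u) x a letters))

  high-sum : ∀ b → wordSum r (suc m) (λ y → highCount (p + v) k v y b) ≡ count p k r b
  high-sum b = begin
    wordSum r (suc m) (λ y → highCount (p + v) k v y b)
      ≡⟨ cong (λ t → wordSum r (suc t) (λ y → highCount (p + v) k v y b)) (sym m≡) ⟩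
    wordSum r (v + r) (λ y → highCount (p + v) k v y b)
      ≡⟨ wordSum-shift r v r (λ y → highCount (p + v) k v y b) (λ y low → highCount-low-letter (p + v) k v y b low) ⟩
    wordSum r r (λ z → highCount (p + v) k v (map (v +_) z) b)
      ≡⟨ wordSum-cong r r (λ z _ letters → highCount-shift p k v b z (Letter⇒positive z letters)) ⟩
    count p k r b ∎

  count-first-high : ∀ j → wordSum m (suc m) (λ w → counted p k j (v ∷ w))
                           ≡ ι B * glue (count (suc p) k (suc u)) (count p k r) j
  count-first-high j = begin
    wordSum m (suc m) (λ w → counted p k j (v ∷ w))
      ≡⟨ cong (λ t → wordSum t (suc m) (λ w → counted p k j (v ∷ w))) (sym m≡) ⟩
    wordSum (suc u + r) (suc m) (λ w → counted p k j (v ∷ w))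
      ≡⟨ wordSum-split (suc u) r (suc m) (λ w → counted p k j (v ∷ w)) ⟩
    wordSum (suc u) (suc m) (λ x → wordSum r (suc m) (λ y → counted p k j (v ∷ x ++ y)))
      ≡⟨ wordSum-cong (suc u) (suc m) (λ x |x| lx → wordSum-cong r (suc m) (λ y |y| ly → pointwise j x y |x| |y| lx ly)) ⟩
    wordSum (suc u) (suc m) (λ x → wordSum r (suc m) (λ y → ι B * glue (lowCount p k v x) (highCount (p + v) k v y) j))
      ≡⟨ wordSum-cong (suc u) (suc m) (λ x _ _ → wordSum-*ˡ r (suc m) (ι B) _) ⟩
    wordSum (suc u) (suc m) (λ x → ι B * wordSum r (suc m) (λ y → glue (lowCount p k v x) (highCount (p + v) k v y) j))
      ≡⟨ wordSum-*ˡ (suc u) (suc m) (ι B) _ ⟩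
    ι B * wordSum (suc u) (suc m) (λ x → wordSum r (suc m) (λ y → glue (lowCount p k v x) (highCount (p + v) k v y) j))
      ≡⟨ cong (ι B *_) (wordSum-glue (suc u) r (suc m) (lowCount p k v) (highCount (p + v) k v) j) ⟩
    ι B * glue (λ a → wordSum (suc u) (suc m) (λ x → lowCount p k v x a)) (λ b → wordSum r (suc m) (λ y → highCount (p + v) k v y b)) j
      ≡⟨ cong (ι B *_) (glue-cong j low-sum high-sum) ⟩
    ι B * glue (count (suc p) k (suc u)) (count p k r) j ∎

-- The weighted first-entry recursion satisfied by the counts.  A first entry e at position
-- p + 1 is allowed iff p + 1 - e ≤ k: entry 1 gives the first term, entry u + 2 the u-th
-- summand.
count-suc : ∀ p k m j → count p k (suc m) j
  ≡ ι (p ≤ᵇ k) * count p k m j + Σ< m (λ u → ι ((p ∸ suc u) ≤ᵇ k) * glue (count (suc p) k (suc u)) (count p k (m ∸ suc u)) j)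
count-suc p k m j = trans (wordSum-suc m (suc m) (counted p k j))
  (cong₂ _+_ (count-first-one p k m j) (Σ-cong m (λ u u<m → FirstEntryHigh.count-first-high p k m u u<m j)))

a231≡count : ∀ k n j → a231 k n j ≡ count 0 k n j
a231≡count k n j = trans (length-filter² (perm-condition n) distinct (words n n))
  (wordSum-cong n n (λ σ |σ| _ → cong ι (subst (λ t → distinct σ ∧ perm-condition t σ ≡ admissible 0 k σ ∧ (descents σ ≡ᵇ j)) |σ|
    (trans (cong₂ (λ c d → distinct σ ∧ (not c ∧ d)) (contains231≡has231 σ)
                  (cong₂ (λ c d → (c ≡ᵇ j) ∧ d) (des≡descents σ) (boundedBy≡bounded k σ)))
           (regroup (distinct σ) (not (has231 σ)) (descents σ ≡ᵇ j) (bounded 0 k σ))))))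
  where
  perm-condition : ℕ → List ℕ → Bool
  perm-condition n σ = not (contains231 n σ) ∧ ((des n σ ≡ᵇ j) ∧ boundedBy n k σ)
  length-filter² : ∀ (P Q : List ℕ → Bool) xs → length (filterᵇ P (filterᵇ Q xs)) ≡ ΣL (λ x → ι (Q x ∧ P x)) xs
  length-filter² P Q []       = refl
  length-filter² P Q (x ∷ xs) with Q x
  ... | false = length-filter² P Q xs
  ... | true with P x
  ...   | true  = cong suc (length-filter² P Q xs)
  ...   | false = length-filter² P Q xs
  regroup : ∀ a b c d → a ∧ (b ∧ (c ∧ d)) ≡ (a ∧ (b ∧ d)) ∧ c
  regroup true  true  c d = ∧-comm c d
  regroup true  false c d = refl
  regroup false b     c d = refl

-- Up to the bound (p ≤ k) every first entry is allowed, so the counts obey the recursion.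
count-recursion : ∀ p k → p ≤ k → FirstEntryRecursion (count (suc p) k) (count p k)
count-recursion p k p≤k = record
  { empty       = λ { zero → refl ; (suc j) → refl }
  ; first-entry = λ m j → trans (count-suc p k m j) (cong₂ _+_
      (trans (cong (_* count p k m j) (ι-≤ p≤k)) (*-identityˡ _))
      (Σ-ext m (λ u → trans (cong (_* glue (count (suc p) k (suc u)) (count p k (m ∸ suc u)) j)
                                   (ι-≤ (≤-trans (m∸n≤m p (suc u)) p≤k)))
                             (*-identityˡ _))))
  }

-- Beyond the bound (k < p) the first entry cannot be 1, and a larger first entry is
-- followed by a nonempty block at offset p + 1 > k; by induction on the length, only the
-- empty word survives.
count-beyond : ∀ p k → k < p → ∀ n j → count p k n j ≡ δ n j
count-beyond p k k<p n j = below (suc n) p k k<p n ≤-refl j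
  where
  below : ∀ N p k → k < p → ∀ n → n < N → ∀ j → count p k n j ≡ δ n j
  below (suc N) p k k<p zero    _         zero    = refl
  below (suc N) p k k<p zero    _         (suc j) = refl
  below (suc N) p k k<p (suc m) (s≤s m<N) j = begin
    count p k (suc m) j
      ≡⟨ count-suc p k m j ⟩
    ι (p ≤ᵇ k) * count p k m j + Σ< m (λ u → ι ((p ∸ suc u) ≤ᵇ k) * glue (count (suc p) k (suc u)) (count p k (m ∸ suc u)) j)
      ≡⟨ cong₂ _+_ (cong (_* count p k m j) (ι-≰ k<p)) (Σ-zero m (λ u u<m →
           trans (cong (ι ((p ∸ suc u) ≤ᵇ k) *_) (glue-zero _ _ j (λ a →
                   below N (suc p) k (≤-trans k<p (n≤1+n p)) (suc u) (<-≤-trans (s≤s u<m) m<N) a)))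
                 (*-zeroʳ (ι ((p ∸ suc u) ≤ᵇ k))))) ⟩
    0 ∎

count≡tower : ∀ e p k → p + e ≡ k → ∀ n j → count p k n j ≡ tower (suc e) n j
count≡tower e p k p+e≡k = recursion-unique (child e p+e≡k) (count-recursion p k (subst (p ≤_) p+e≡k (m≤m+n p e))) (tower-recursion e)
  where
  child : ∀ e → p + e ≡ k → ∀ n i → count (suc p) k n i ≡ tower e n i
  child zero     p≡k = count-beyond (suc p) k (s≤s (≤-reflexive (sym (trans (sym (+-identityʳ p)) p≡k))))
  child (suc e′) eq  = count≡tower e′ (suc p) k (trans (sym (+-suc p e′)) eq)

theorem20 : (n j k : ℕ) → 2 ≤ k → a231 k n j ≡ rhs k n j
theorem20 n j (suc k) _ = begin
  a231 (suc k) n j              ≡⟨ a231≡count (suc k) n j ⟩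
  count 0 (suc k) n j           ≡⟨ count≡tower (suc k) 0 (suc k) refl n j ⟩
  tower (suc (suc k)) n j       ≡⟨ sym (rhs≡tower k n j) ⟩
  rhs (suc k) n j               ∎
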